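{- For each positive integer $N$, \[ \varphi_N(x,x^2,\ldots,x^N)=\sum_{\alpha\in\mathrm{OC}_{\le N}}(-1)^{\lfloor(\ell(\alpha)+1)/2\rfloor}x^{S_N(\alpha)}=\sum_{s=0}^{N(N+1)/2}c_s(N)x^s, \] where, writing $q_j,r_j$ for the quotient and remainder of $s$ upon division by $N+j$ ($j\in\{0,1\}$), \[ c_s(N)=\begin{cases}1 & s=0,\\ (-1)^{q_1+1}\binom{N-r_1}{q_1}\binom{q_1+r_1-\lfloor N/2\rfloor-1}{q_1} & \lfloor 2s/(N+1)\rfloor\text{ odd and } r_1>\lfloor N/2\rfloor,\\ (-1)^{q_0}\binom{r_0-1}{q_0-1}\binom{\lfloor N/2\rfloor-r_0+q_0}{q_0} & \lfloor 2s/(N+1)\rfloor\text{ even and } r_0\le\lfloor N/2\rfloor,\\ 0 & \text{otherwise.}\end{cases} \]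
   Context: An odd composition is a finite sequence of odd positive integers; $\mathrm{OC}_{\le N}$ is the set of odd compositions of integers in $\{0,\ldots,N\}$ (including the empty one); $\ell(\alpha)$ is the number of parts. $\sigma_N$ is the permutation of $\{1,\ldots,N\}$ with $\sigma_N(i)=i/2$ for $i$ even and $\sigma_N(i)=N+(1-i)/2$ for $i$ odd; $S_N(\alpha)=\sum_{i=1}^{\ell(\alpha)}\sigma_N(\alpha_1+\cdots+\alpha_i)$. The polynomial $\varphi_N(x_1,\ldots,x_N)=\sum_{\alpha\in\mathrm{OC}_{\le N}}(-1)^{\lfloor(\ell(\alpha)+1)/2\rfloor}\prod_{i=1}^{\ell(\alpha)}x_{\sigma_N(\alpha_1+\cdots+\alpha_i)}$. Binomial coefficients $\binom{n}{j}$ are $0$ when $j<0$ or when $n$ or $j$ is not an integer. -}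

module Defs where

open import Data.Bool using (Bool; true; false; if_then_else_; _∧_; not)
open import Data.Nat as ℕ using (ℕ; zero; suc; _∸_; _≡ᵇ_; _<ᵇ_; _≤ᵇ_; NonZero)
open import Data.Nat.DivMod using (_/_; _%_)
open import Data.Nat.Combinatorics using (_C_)
open import Data.Integer as ℤ using (ℤ; +_; -[1+_])
open import Data.List using (List; []; _∷_; [_]; map; concatMap; concat; filterᵇ; length; upTo)

isOdd : ℕ → Bool
isOdd n = n % 2 ≡ᵇ 1

isEven : ℕ → Bool
isEven n = not (isOdd n)

range1 : ℕ → List ℕ
range1 n = map suc (upTo n)

-- oddCompsF fuel n : all compositions of n into odd positive parts
-- (fuel ≥ n suffices, since each part is ≥ 1)
oddCompsF : ℕ → ℕ → List (List ℕ)
oddCompsF _        zero    = [ [] ]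
oddCompsF zero     (suc n) = []
oddCompsF (suc f)  (suc n) =
  concatMap (λ k → map (k ∷_) (oddCompsF f (suc n ∸ k)))
            (filterᵇ isOdd (range1 (suc n)))

oddComps : ℕ → List (List ℕ)
oddComps n = oddCompsF n n

OC≤ : ℕ → List (List ℕ)
OC≤ N = concatMap oddComps (upTo (suc N))

σ : ℕ → ℕ → ℕ
σ N i = if isEven i then i / 2 else N ∸ ((i ∸ 1) / 2)

S-acc : ℕ → ℕ → List ℕ → ℕ
S-acc N acc []       = 0
S-acc N acc (a ∷ as) = σ N (acc ℕ.+ a) ℕ.+ S-acc N (acc ℕ.+ a) as

S : ℕ → List ℕ → ℕ
S N α = S-acc N 0 α

sgn : ℕ → ℤ
sgn k = if isEven k then + 1 else ℤ.- (+ 1)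

signOC : List ℕ → ℤ
signOC α = sgn ((length α ℕ.+ 1) / 2)

sumℤ : List ℤ → ℤ
sumℤ []       = + 0
sumℤ (x ∷ xs) = x ℤ.+ sumℤ xs

-- coefficient of x^s in φ_N(x, x², ..., x^N) = Σ_{α ∈ OC_{≤N}} (-1)^{⌊(ℓ(α)+1)/2⌋} x^{S_N(α)}
coeffφ : ℕ → ℕ → ℤ
coeffφ N s = sumℤ (map (λ α → if S N α ≡ᵇ s then signOC α else + 0) (OC≤ N))

-- generalized binomial coefficient (n choose j) for integers n, j:
-- 0 when j < 0; the usual one for n ≥ 0; (-1)^j (m+j choose j) for n = -(m+1), j ≥ 0
binomℤ : ℤ → ℤ → ℤ
binomℤ n        -[1+ _ ] = + 0
binomℤ (+ n)    (+ j)    = + (n C j)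
binomℤ -[1+ m ] (+ j)    = sgn j ℤ.* + ((m ℕ.+ j) C j)

c : (N : ℕ) → .{{NonZero N}} → ℕ → ℤ
c N zero = + 1
c N s@(suc _) =
  if isOdd t ∧ (h <ᵇ r₁) then
    sgn (q₁ ℕ.+ 1) ℤ.* binomℤ (+ N ℤ.- + r₁) (+ q₁)
                   ℤ.* binomℤ (+ q₁ ℤ.+ + r₁ ℤ.- + h ℤ.- + 1) (+ q₁)
  else if isEven t ∧ (r₀ ≤ᵇ h) then
    sgn q₀ ℤ.* binomℤ (+ r₀ ℤ.- + 1) (+ q₀ ℤ.- + 1)
           ℤ.* binomℤ (+ h ℤ.- + r₀ ℤ.+ + q₀) (+ q₀)
  else + 0
  where
  q₀ = s / N
  r₀ = s % N
  q₁ = s / suc N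
  r₁ = s % suc N
  h  = N / 2
  t  = (2 ℕ.* s) / suc N

-- Cutting an odd composition after its first part gives a recursion for the generating series
-- T j p of the possible tails after partial sum p (with j parts placed): the next part is either 1,
-- contributing x^σ(p+1) T (j+1) (p+1), or at least 3 and can be shortened by 2, giving T j (p+2).
-- At even positions 2c and odd positions 2a+1 this is the coupled system
--   A c = A (c+1) − x^(N−c) B c,    B a = B (a+1) + x^(a+1) A (a+1),
-- with A c = 1 once 2c ≥ N, B a = 1 once 2a+1 ≥ N, and φ_N(x, …, x^N) = A 0. Explicit series,
-- sums of x^((m+1)N+D) and x^(m(N+1)+r) times products of two binomial coefficients, satisfy the
-- same system termwise by Pascal's rule. In the closed form of A 0 at most one term of each kind
-- has degree s, located by dividing s by N and by N+1; it is nonzero only for remainders in a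
-- window, and the parity of ⌊2s/(N+1)⌋ tells which window s lies in.
module Submission where

open import Defs
open import Function using (_∘_; id)
open import Data.Bool using (Bool; true; false; if_then_else_; not; _∧_; T)
open import Data.Bool.Properties using (T-∧)
open import Data.Empty using (⊥; ⊥-elim)
open import Data.Nat as ℕ using (ℕ; zero; suc; _∸_; _≡ᵇ_; _<ᵇ_; _≤ᵇ_; NonZero; z≤n; s≤s)
import Data.Nat.Properties as ℕP
open import Data.Nat.DivMod
open import Data.Nat.Divisibility using (n∣m*n)
open import Data.Nat.Combinatorics using (_C_; k>n⇒nCk≡0; nCk+nC[k+1]≡[n+1]C[k+1])
import Data.Nat.Tactic.RingSolver as ℕSolver
open import Data.Integer as ℤ using (ℤ; +_; -[1+_]; +<+; _⊖_)
import Data.Integer.Properties as ℤP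
open import Data.Integer.Tactic.RingSolver using (solve-∀)
open import Data.List using (List; []; _∷_; map; concatMap; filterᵇ; length; upTo; applyUpTo; _++_)
import Data.List.Properties as ListP
open import Data.Product using (_×_; _,_; proj₁; proj₂)
open import Function.Bundles using (Equivalence)
open import Relation.Nullary using (¬_; yes; no)
open import Relation.Binary.PropositionalEquality

module Series where

  open import Data.Integer using (_+_; _-_; _*_; -_)

  ∸≡suc∸suc : ∀ {m n} → n ℕ.< m → m ∸ n ≡ suc (m ∸ suc n)
  ∸≡suc∸suc {suc m} {zero}  _         = refl
  ∸≡suc∸suc {suc m} {suc n} (s≤s n<m) = ∸≡suc∸suc n<m

  ∸[m+m]-step : ∀ n c {k} → n ∸ (c ℕ.+ c) ℕ.≤ suc k → n ∸ (suc c ℕ.+ suc c) ℕ.≤ k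
  ∸[m+m]-step n c {k} bound = begin
    n ∸ (suc c ℕ.+ suc c)      ≡⟨ cong (λ x → n ∸ suc x) (ℕP.+-suc c c) ⟩
    n ∸ suc (suc (c ℕ.+ c))    ≤⟨ ℕP.∸-monoʳ-≤ n (ℕP.n≤1+n (suc (c ℕ.+ c))) ⟩
    n ∸ suc (c ℕ.+ c)          ≡⟨ ℕP.pred[m∸n]≡m∸[1+n] n (c ℕ.+ c) ⟨
    ℕ.pred (n ∸ (c ℕ.+ c))     ≤⟨ ℕP.pred-mono-≤ bound ⟩
    k                          ∎
    where open ℕP.≤-Reasoning

  m+m≤1+n⇒m≤n : ∀ {m n} → m ℕ.+ m ℕ.≤ suc n → m ℕ.≤ n
  m+m≤1+n⇒m≤n {zero}  _         = z≤n
  m+m≤1+n⇒m≤n {suc m} (s≤s le) = ℕP.≤-trans (ℕP.m≤n+m (suc m) m) le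

  m+m≤1+n+n⇒m≤n : ∀ {m n} → m ℕ.+ m ℕ.≤ suc (n ℕ.+ n) → m ℕ.≤ n
  m+m≤1+n+n⇒m≤n {zero}          _        = z≤n
  m+m≤1+n+n⇒m≤n {suc m} {zero}  (s≤s le) with () ← ℕP.≤-trans (ℕP.m≤n+m (suc m) m) le
  m+m≤1+n+n⇒m≤n {suc m} {suc n} (s≤s le) = s≤s (m+m≤1+n+n⇒m≤n (ℕP.≤-pred (begin
    suc (m ℕ.+ m)     ≡⟨ ℕP.+-suc m m ⟨
    m ℕ.+ suc m       ≤⟨ le ⟩
    suc (n ℕ.+ suc n) ≡⟨ cong suc (ℕP.+-suc n n) ⟩
    suc (suc (n ℕ.+ n)) ∎)))
    where open ℕP.≤-Reasoning

  [2+m]/2 : ∀ m → suc (suc m) / 2 ≡ suc (m / 2)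
  [2+m]/2 m = m/n≡1+[m∸n]/n {suc (suc m)} {2} (s≤s (s≤s z≤n))

  [m+m]/2≡m : ∀ m → (m ℕ.+ m) / 2 ≡ m
  [m+m]/2≡m zero    = refl
  [m+m]/2≡m (suc m) = begin
    (suc m ℕ.+ suc m) / 2     ≡⟨ cong (λ n → suc n / 2) (ℕP.+-suc m m) ⟩
    suc (suc (m ℕ.+ m)) / 2   ≡⟨ [2+m]/2 (m ℕ.+ m) ⟩
    suc ((m ℕ.+ m) / 2)       ≡⟨ cong suc ([m+m]/2≡m m) ⟩
    suc m                     ∎
    where open ≡-Reasoning

  ≤/2⇒2*≤ : ∀ {s x} → s ℕ.≤ x / 2 → 2 ℕ.* s ℕ.≤ x
  ≤/2⇒2*≤ {s} {x} s≤x/2 = ℕP.≤-trans (ℕP.*-monoʳ-≤ 2 s≤x/2) (subst (ℕ._≤ x) (ℕP.*-comm (x / 2) 2) (m/n*n≤m x 2))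

  2*≤⇒≤/2 : ∀ {s x} → 2 ℕ.* s ℕ.≤ x → s ℕ.≤ x / 2
  2*≤⇒≤/2 {s} {x} 2s≤x = subst (ℕ._≤ x / 2) (trans (cong (_/ 2) (ℕP.*-comm 2 s)) (m*n/n≡m s 2)) (/-monoˡ-≤ 2 2s≤x)

  [r+kn]/n≡k : ∀ {r n} k .{{_ : NonZero n}} → r ℕ.< n → (r ℕ.+ k ℕ.* n) / n ≡ k
  [r+kn]/n≡k {r} {n} k r<n = trans (+-distrib-/-∣ʳ r (n∣m*n k)) (cong₂ ℕ._+_ (m<n⇒m/n≡0 r<n) (m*n/n≡m k n))

  isOdd-+2 : ∀ m → isOdd (suc (suc m)) ≡ isOdd m
  isOdd-+2 m = cong (_≡ᵇ 1) (trans (cong (_% 2) (ℕP.+-comm 2 m)) ([m+n]%n≡m%n m 2))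

  isOdd-double : ∀ m → isOdd (m ℕ.+ m) ≡ false
  isOdd-double zero    = refl
  isOdd-double (suc m) = begin
    isOdd (suc m ℕ.+ suc m)   ≡⟨ cong (isOdd ∘ suc) (ℕP.+-suc m m) ⟩
    isOdd (suc (suc (m ℕ.+ m))) ≡⟨ isOdd-+2 (m ℕ.+ m) ⟩
    isOdd (m ℕ.+ m)           ≡⟨ isOdd-double m ⟩
    false                     ∎
    where open ≡-Reasoning

  isOdd-suc-double : ∀ m → isOdd (suc (m ℕ.+ m)) ≡ true
  isOdd-suc-double zero    = refl
  isOdd-suc-double (suc m) = begin
    isOdd (suc (suc m ℕ.+ suc m))     ≡⟨ cong (isOdd ∘ suc ∘ suc) (ℕP.+-suc m m) ⟩
    isOdd (suc (suc (suc (m ℕ.+ m)))) ≡⟨ isOdd-+2 (suc (m ℕ.+ m)) ⟩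
    isOdd (suc (m ℕ.+ m))             ≡⟨ isOdd-suc-double m ⟩
    true                              ∎
    where open ≡-Reasoning

  sgn-+2 : ∀ m → sgn (suc (suc m)) ≡ sgn m
  sgn-+2 m = cong (λ b → if not b then + 1 else ℤ.- (+ 1)) (isOdd-+2 m)

  sgn-suc : ∀ m → sgn (suc m) ≡ - sgn m
  sgn-suc zero          = refl
  sgn-suc (suc zero)    = refl
  sgn-suc (suc (suc m)) = begin
    sgn (suc (suc (suc m))) ≡⟨ sgn-+2 (suc m) ⟩
    sgn (suc m)             ≡⟨ sgn-suc m ⟩
    - sgn m                 ≡⟨ cong -_ (sgn-+2 m) ⟨
    - sgn (suc (suc m))     ∎
    where open ≡-Reasoning

  σ-double : ∀ N c → σ N (c ℕ.+ c) ≡ c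
  σ-double N c rewrite isOdd-double c = [m+m]/2≡m c

  σ-suc-double : ∀ N c → σ N (suc (c ℕ.+ c)) ≡ N ∸ c
  σ-suc-double N c rewrite isOdd-suc-double c = cong (N ∸_) ([m+m]/2≡m c)

  T-not-both : ∀ b → T (not b) → T b → ⊥
  T-not-both true  () _
  T-not-both false _  ()

  if-else-if-elim : ∀ {b₁ b₂ : Bool} {x y v : ℤ} → (T b₁ → x ≡ v) → (¬ T b₁ → T b₂ → y ≡ v) →
    (¬ T b₁ → ¬ T b₂ → + 0 ≡ v) → (if b₁ then x else if b₂ then y else + 0) ≡ v
  if-else-if-elim {true}          on-x _    _    = on-x _
  if-else-if-elim {false} {true}  _    on-y _    = on-y (λ ()) _
  if-else-if-elim {false} {false} _    _    on-0 = on-0 (λ ()) (λ ())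

  -- Unlike binomℤ, choose vanishes on every negative upper argument; this makes Pascal's rule
  -- hold for all integers.
  choose : ℤ → ℕ → ℤ
  choose (+ n)    k = + (n C k)
  choose -[1+ n ] k = + 0

  choose-pascal : ∀ x k → choose (x + + 1) (suc k) ≡ choose x k + choose x (suc k)
  choose-pascal (+ n) k = begin
    + ((n ℕ.+ 1) C suc k)    ≡⟨ cong (λ m → + (m C suc k)) (ℕP.+-comm n 1) ⟩
    + (suc n C suc k)        ≡⟨ cong +_ (nCk+nC[k+1]≡[n+1]C[k+1] n k) ⟨
    + (n C k ℕ.+ n C suc k)  ∎
    where open ≡-Reasoning
  choose-pascal -[1+ zero  ] k = refl
  choose-pascal -[1+ suc n ] k = refl

  choose-< : ∀ {x k} → x ℤ.< + k → choose x k ≡ + 0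
  choose-< {+ n}    (+<+ n<k) = cong +_ (k>n⇒nCk≡0 n<k)
  choose-< { -[1+ n ]} _      = refl

  choose-vanishes : ∀ {x k} a b → x ≡ + a - + b → a ℕ.< k ℕ.+ b → choose x k ≡ + 0
  choose-vanishes {k = k} a b refl a<k+b = choose-< (begin-strict
    + a - + b       ≡⟨ ℤP.m-n≡m⊖n a b ⟩
    a ⊖ b           <⟨ ℤP.⊖-monoˡ-< b a<k+b ⟩
    (k ℕ.+ b) ⊖ b   ≡⟨ ℤP.⊖-≥ (ℕP.m≤n+m b k) ⟩
    + (k ℕ.+ b ∸ b) ≡⟨ cong +_ (ℕP.m+n∸n≡m k b) ⟩
    + k             ∎)
    where open ℤP.≤-Reasoning

  choose-0≡1 : ∀ {x} a b → x ≡ + a - + b → b ℕ.≤ a → choose x 0 ≡ + 1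
  choose-0≡1 a b refl b≤a rewrite ℤP.m-n≡m⊖n a b | ℤP.⊖-≥ b≤a = refl

  binomℤ≡choose : ∀ {a b} j → b ℕ.≤ a → binomℤ (+ a - + b) (+ j) ≡ choose (+ a - + b) j
  binomℤ≡choose {a} {b} j b≤a rewrite ℤP.m-n≡m⊖n a b | ℤP.⊖-≥ b≤a = refl

  middle≡0⇒product≡0 : ∀ s {a} b → a ≡ + 0 → s * a * b ≡ + 0
  middle≡0⇒product≡0 s b refl = trans (cong (_* b) (ℤP.*-zeroʳ s)) (ℤP.*-zeroˡ b)

  last≡0⇒product≡0 : ∀ s a {b} → b ≡ + 0 → s * a * b ≡ + 0
  last≡0⇒product≡0 s a refl = ℤP.*-zeroʳ (s * a)

  sumTo : ℕ → (ℕ → ℤ) → ℤ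
  sumTo zero    f = + 0
  sumTo (suc n) f = f 0 + sumTo n (f ∘ suc)

  sumTo-cong : ∀ n {f g : ℕ → ℤ} → f ≗ g → sumTo n f ≡ sumTo n g
  sumTo-cong zero    f≗g = refl
  sumTo-cong (suc n) f≗g = cong₂ _+_ (f≗g 0) (sumTo-cong n (f≗g ∘ suc))

  sumTo-+ : ∀ n (f g : ℕ → ℤ) → sumTo n (λ i → f i + g i) ≡ sumTo n f + sumTo n g
  sumTo-+ zero    f g = refl
  sumTo-+ (suc n) f g = begin
    f 0 + g 0 + sumTo n (λ i → f (suc i) + g (suc i))   ≡⟨ cong (_+_ (f 0 + g 0)) (sumTo-+ n (f ∘ suc) (g ∘ suc)) ⟩
    f 0 + g 0 + (sumTo n (f ∘ suc) + sumTo n (g ∘ suc)) ≡⟨ interchange (f 0) (g 0) _ _ ⟩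
    f 0 + sumTo n (f ∘ suc) + (g 0 + sumTo n (g ∘ suc)) ∎
    where
    open ≡-Reasoning
    interchange : ∀ a b c d → a + b + (c + d) ≡ a + c + (b + d)
    interchange = solve-∀

  sumTo-neg : ∀ n (f : ℕ → ℤ) → sumTo n (λ i → - f i) ≡ - sumTo n f
  sumTo-neg zero    f = refl
  sumTo-neg (suc n) f =
    trans (cong (_+_ (- f 0)) (sumTo-neg n (f ∘ suc))) (sym (ℤP.neg-distrib-+ (f 0) _))

  sumTo-- : ∀ n (f g : ℕ → ℤ) → sumTo n (λ i → f i - g i) ≡ sumTo n f - sumTo n g
  sumTo-- n f g = trans (sumTo-+ n f (λ i → - g i)) (cong (_+_ (sumTo n f)) (sumTo-neg n g))

  sumTo-snoc : ∀ n (f : ℕ → ℤ) → sumTo (suc n) f ≡ sumTo n f + f n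
  sumTo-snoc zero    f = ℤP.+-comm (f 0) (+ 0)
  sumTo-snoc (suc n) f =
    trans (cong (_+_ (f 0)) (sumTo-snoc n (f ∘ suc))) (sym (ℤP.+-assoc (f 0) _ _))

  sumTo-zeros : ∀ n {f : ℕ → ℤ} → (∀ i → f i ≡ + 0) → sumTo n f ≡ + 0
  sumTo-zeros zero    f≡0 = refl
  sumTo-zeros (suc n) f≡0 = cong₂ _+_ (f≡0 0) (sumTo-zeros n (f≡0 ∘ suc))

  sumTo-select : ∀ n k (f : ℕ → ℤ) → (n ℕ.≤ k → f k ≡ + 0) →
    sumTo n (λ i → if i ≡ᵇ k then f i else + 0) ≡ f k
  sumTo-select zero    k       f f≡0 = sym (f≡0 z≤n)
  sumTo-select (suc n) zero    f f≡0 = trans (cong (_+_ (f 0)) (sumTo-zeros n (λ _ → refl))) (ℤP.+-identityʳ (f 0))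
  sumTo-select (suc n) (suc k) f f≡0 = trans (ℤP.+-identityˡ _) (sumTo-select n k (f ∘ suc) (f≡0 ∘ s≤s))

  sumℤ-++ : ∀ (xs ys : List ℤ) → sumℤ (xs ++ ys) ≡ sumℤ xs + sumℤ ys
  sumℤ-++ []       ys = sym (ℤP.+-identityˡ _)
  sumℤ-++ (x ∷ xs) ys = trans (cong (_+_ x) (sumℤ-++ xs ys)) (sym (ℤP.+-assoc x _ _))

  sumℤ-concatMap : ∀ {A B : Set} (g : B → ℤ) (F : A → List B) (xs : List A) →
    sumℤ (map g (concatMap F xs)) ≡ sumℤ (map (λ x → sumℤ (map g (F x))) xs)
  sumℤ-concatMap g F []       = refl
  sumℤ-concatMap g F (x ∷ xs) = begin
    sumℤ (map g (F x ++ concatMap F xs))                 ≡⟨ cong sumℤ (ListP.map-++ g (F x) _) ⟩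
    sumℤ (map g (F x) ++ map g (concatMap F xs))          ≡⟨ sumℤ-++ (map g (F x)) _ ⟩
    sumℤ (map g (F x)) + sumℤ (map g (concatMap F xs))    ≡⟨ cong (_+_ (sumℤ (map g (F x)))) (sumℤ-concatMap g F xs) ⟩
    sumℤ (map g (F x)) + sumℤ (map (λ y → sumℤ (map g (F y))) xs) ∎
    where open ≡-Reasoning

  sumℤ-filterᵇ : ∀ {A : Set} (P : A → Bool) (g : A → ℤ) (xs : List A) →
    sumℤ (map g (filterᵇ P xs)) ≡ sumℤ (map (λ x → if P x then g x else + 0) xs)
  sumℤ-filterᵇ P g []       = refl
  sumℤ-filterᵇ P g (x ∷ xs) with P x
  ... | true  = cong (_+_ (g x)) (sumℤ-filterᵇ P g xs)
  ... | false = trans (sumℤ-filterᵇ P g xs) (sym (ℤP.+-identityˡ _))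

  sumℤ-applyUpTo : ∀ (g : ℕ → ℤ) (f : ℕ → ℕ) n → sumℤ (map g (applyUpTo f n)) ≡ sumTo n (g ∘ f)
  sumℤ-applyUpTo g f zero    = refl
  sumℤ-applyUpTo g f (suc n) = cong (_+_ (g (f 0))) (sumℤ-applyUpTo g (f ∘ suc) n)

  sumℤ-cong : ∀ {A : Set} {g g′ : A → ℤ} → g ≗ g′ → ∀ xs → sumℤ (map g xs) ≡ sumℤ (map g′ xs)
  sumℤ-cong g≗g′ xs = cong sumℤ (ListP.map-cong g≗g′ xs)

  sumℤ-neg : ∀ {A : Set} (g : A → ℤ) (xs : List A) → sumℤ (map (λ x → - g x) xs) ≡ - sumℤ (map g xs)
  sumℤ-neg g []       = refl
  sumℤ-neg g (x ∷ xs) = trans (cong (_+_ (- g x)) (sumℤ-neg g xs)) (sym (ℤP.neg-distrib-+ (g x) _))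

  -- Coefficient sequences; shift k f is x^k f

  δ : ℕ → ℤ
  δ zero    = + 1
  δ (suc _) = + 0

  shift : ℕ → (ℕ → ℤ) → ℕ → ℤ
  shift zero    f s       = f s
  shift (suc k) f zero    = + 0
  shift (suc k) f (suc s) = shift k f s

  shift-cong : ∀ k {f g : ℕ → ℤ} → f ≗ g → shift k f ≗ shift k g
  shift-cong zero    f≗g s       = f≗g s
  shift-cong (suc k) f≗g zero    = refl
  shift-cong (suc k) f≗g (suc s) = shift-cong k f≗g s

  shift-+ : ∀ k (f g : ℕ → ℤ) s → shift k (λ x → f x + g x) s ≡ shift k f s + shift k g s
  shift-+ zero    f g s       = refl
  shift-+ (suc k) f g zero    = refl
  shift-+ (suc k) f g (suc s) = shift-+ k f g s

  shift-neg : ∀ k (f : ℕ → ℤ) s → shift k (λ x → - f x) s ≡ - shift k f s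
  shift-neg zero    f s       = refl
  shift-neg (suc k) f zero    = refl
  shift-neg (suc k) f (suc s) = shift-neg k f s

  shift-- : ∀ k (f g : ℕ → ℤ) s → shift k (λ x → f x - g x) s ≡ shift k f s - shift k g s
  shift-- k f g s = trans (shift-+ k f (λ x → - g x) s) (cong (_+_ (shift k f s)) (shift-neg k g s))

  shift-zeros : ∀ k {f : ℕ → ℤ} → (∀ x → f x ≡ + 0) → ∀ s → shift k f s ≡ + 0
  shift-zeros zero    f≡0 s       = f≡0 s
  shift-zeros (suc k) f≡0 zero    = refl
  shift-zeros (suc k) f≡0 (suc s) = shift-zeros k f≡0 s

  shift-shift : ∀ a b (f : ℕ → ℤ) s → shift a (shift b f) s ≡ shift (a ℕ.+ b) f s
  shift-shift zero    b f s       = refl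
  shift-shift (suc a) b f zero    = refl
  shift-shift (suc a) b f (suc s) = shift-shift a b f s

  shift-comm : ∀ a b (f : ℕ → ℤ) s → shift a (shift b f) s ≡ shift b (shift a f) s
  shift-comm a b f s = begin
    shift a (shift b f) s ≡⟨ shift-shift a b f s ⟩
    shift (a ℕ.+ b) f s   ≡⟨ cong (λ k → shift k f s) (ℕP.+-comm a b) ⟩
    shift (b ℕ.+ a) f s   ≡⟨ shift-shift b a f s ⟨
    shift b (shift a f) s ∎
    where open ≡-Reasoning

  shift-at : ∀ k (f : ℕ → ℤ) d → shift k f (k ℕ.+ d) ≡ f d
  shift-at zero    f d = refl
  shift-at (suc k) f d = shift-at k f d

  shift-below : ∀ k (f : ℕ → ℤ) {s} → s ℕ.< k → shift k f s ≡ + 0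
  shift-below (suc k) f {zero}  _         = refl
  shift-below (suc k) f {suc s} (s≤s s<k) = shift-below k f s<k

  shift-≗ : ∀ k {f g : ℕ → ℤ} → (∀ d → f d ≡ g (k ℕ.+ d)) → (∀ s → s ℕ.< k → g s ≡ + 0) → shift k f ≗ g
  shift-≗ zero    f≡g g≡0 s       = f≡g s
  shift-≗ (suc k) f≡g g≡0 zero    = sym (g≡0 0 (s≤s z≤n))
  shift-≗ (suc k) f≡g g≡0 (suc s) = shift-≗ k f≡g (λ s s<k → g≡0 (suc s) (s≤s s<k)) s

  shift-shift-≗ : ∀ k x c {f g : ℕ → ℤ} → shift c f ≗ g → shift (k ℕ.+ x ℕ.+ c) f ≗ shift k (shift x g)
  shift-shift-≗ k x c {f} {g} f≗g s = begin
    shift (k ℕ.+ x ℕ.+ c) f s      ≡⟨ shift-shift (k ℕ.+ x) c f s ⟨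
    shift (k ℕ.+ x) (shift c f) s  ≡⟨ shift-shift k x (shift c f) s ⟨
    shift k (shift x (shift c f)) s ≡⟨ shift-cong k (shift-cong x f≗g) s ⟩
    shift k (shift x g) s          ∎
    where open ≡-Reasoning

  shift-split : ∀ k (f g : ℕ → ℤ) s → shift k f s ≡ shift k g s + shift k (λ x → f x - g x) s
  shift-split k f g s = trans (add-back (shift k f s) (shift k g s)) (cong (_+_ (shift k g s)) (sym (shift-- k f g s)))
    where
    add-back : ∀ a b → a ≡ b + (a - b)
    add-back = solve-∀

  shift-sumTo : ∀ k n (F : ℕ → ℕ → ℤ) s →
    shift k (λ x → sumTo n (λ i → F i x)) s ≡ sumTo n (λ i → shift k (F i) s)
  shift-sumTo zero    n F s       = refl
  shift-sumTo (suc k) n F zero    = sym (sumTo-zeros n (λ _ → refl))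
  shift-sumTo (suc k) n F (suc s) = shift-sumTo k n F s

  shift-sumℤ : ∀ {A : Set} k (F : A → ℕ → ℤ) (xs : List A) s →
    shift k (λ x → sumℤ (map (λ a → F a x) xs)) s ≡ sumℤ (map (λ a → shift k (F a) s) xs)
  shift-sumℤ k F []       s = shift-zeros k (λ _ → refl) s
  shift-sumℤ k F (a ∷ xs) s = trans (shift-+ k (F a) _ s) (cong (_+_ (shift k (F a) s)) (shift-sumℤ k F xs s))

  shift-δ+sums : ∀ k n n′ (F G : ℕ → ℕ → ℤ) s →
    shift k (λ x → δ x + (sumTo n (λ m → F m x) + sumTo n′ (λ m → G m x))) s
    ≡ shift k δ s + (sumTo n (λ m → shift k (F m) s) + sumTo n′ (λ m → shift k (G m) s))
  shift-δ+sums k n n′ F G s = begin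
    shift k (λ x → δ x + (sumTo n (λ m → F m x) + sumTo n′ (λ m → G m x))) s
      ≡⟨ shift-+ k δ _ s ⟩
    shift k δ s + shift k (λ x → sumTo n (λ m → F m x) + sumTo n′ (λ m → G m x)) s
      ≡⟨ cong (_+_ (shift k δ s)) (shift-+ k _ _ s) ⟩
    shift k δ s + (shift k (λ x → sumTo n (λ m → F m x)) s + shift k (λ x → sumTo n′ (λ m → G m x)) s)
      ≡⟨ cong₂ (λ u v → shift k δ s + (u + v)) (shift-sumTo k n F s) (shift-sumTo k n′ G s) ⟩
    shift k δ s + (sumTo n (λ m → shift k (F m) s) + sumTo n′ (λ m → shift k (G m) s)) ∎
    where open ≡-Reasoning

  shift-indicator : ∀ a b (x : ℤ) s →
    (if a ℕ.+ b ≡ᵇ s then x else + 0) ≡ shift a (λ s′ → if b ≡ᵇ s′ then x else + 0) s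
  shift-indicator zero    b x s       = refl
  shift-indicator (suc a) b x zero    = refl
  shift-indicator (suc a) b x (suc s) = shift-indicator a b x s

  shift-multiple : ∀ n k (f : ℕ → ℤ) q {r} → r ℕ.< n → (∀ D → n ℕ.≤ D → f D ≡ + 0) →
    shift (k ℕ.* n) f (r ℕ.+ q ℕ.* n) ≡ (if k ≡ᵇ q then f r else + 0)
  shift-multiple n zero    f zero    {r} r<n f≡0 = cong f (ℕP.+-identityʳ r)
  shift-multiple n zero    f (suc q) {r} r<n f≡0 =
    f≡0 (r ℕ.+ suc q ℕ.* n) (ℕP.≤-trans (ℕP.m≤m+n n (q ℕ.* n)) (ℕP.m≤n+m (suc q ℕ.* n) r))
  shift-multiple n (suc k) f zero    {r} r<n f≡0 =
    shift-below (suc k ℕ.* n) f (ℕP.<-≤-trans (subst (ℕ._< n) (sym (ℕP.+-identityʳ r)) r<n) (ℕP.m≤m+n n (k ℕ.* n)))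
  shift-multiple n (suc k) f (suc q) {r} r<n f≡0 = begin
    shift (n ℕ.+ k ℕ.* n) f (r ℕ.+ (n ℕ.+ q ℕ.* n))  ≡⟨ shift-shift n (k ℕ.* n) f _ ⟨
    shift n (shift (k ℕ.* n) f) (r ℕ.+ (n ℕ.+ q ℕ.* n))
      ≡⟨ cong (shift n (shift (k ℕ.* n) f)) (swap r n (q ℕ.* n)) ⟩
    shift n (shift (k ℕ.* n) f) (n ℕ.+ (r ℕ.+ q ℕ.* n)) ≡⟨ shift-at n (shift (k ℕ.* n) f) _ ⟩
    shift (k ℕ.* n) f (r ℕ.+ q ℕ.* n)                  ≡⟨ shift-multiple n k f q r<n f≡0 ⟩
    (if k ≡ᵇ q then f r else + 0)                       ∎
    where
    open ≡-Reasoning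
    swap : ∀ a b c → a ℕ.+ (b ℕ.+ c) ≡ b ℕ.+ (a ℕ.+ c)
    swap = ℕSolver.solve-∀

open Series

module CompositionSeries (N : ℕ) where

  open import Data.Integer using (_+_; _-_; -_)

  -- α is weighted as the tail of a composition whose first j parts sum to p.
  weight : ℕ → ℕ → ℕ → List ℕ → ℤ
  weight j p s α = if S-acc N p α ≡ᵇ s then sgn ((j ℕ.+ length α ℕ.+ 1) / 2) else + 0

  seriesWithFuel : ℕ → ℕ → ℕ → ℕ → ℕ → ℤ
  seriesWithFuel f j p n s = sumℤ (map (weight j p s) (oddCompsF f n))

  weight-∷ : ∀ j p s k α →
    weight j p s (k ∷ α) ≡ shift (σ N (p ℕ.+ k)) (λ s′ → weight (suc j) (p ℕ.+ k) s′ α) s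
  weight-∷ j p s k α = trans
    (cong (λ e → if σ N (p ℕ.+ k) ℕ.+ S-acc N (p ℕ.+ k) α ≡ᵇ s then sgn ((e ℕ.+ 1) / 2) else + 0)
          (ℕP.+-suc j (length α)))
    (shift-indicator (σ N (p ℕ.+ k)) (S-acc N (p ℕ.+ k) α) _ s)

  seriesWithFuel-suc : ∀ f j p n s → seriesWithFuel (suc f) j p (suc n) s ≡
    sumTo (suc n) (λ i → if isOdd (suc i)
                         then shift (σ N (p ℕ.+ suc i)) (seriesWithFuel f (suc j) (p ℕ.+ suc i) (n ∸ i)) s
                         else + 0)
  seriesWithFuel-suc f j p n s = begin
    sumℤ (map (weight j p s) (concatMap tails (filterᵇ isOdd (map suc (upTo (suc n))))))
      ≡⟨ sumℤ-concatMap (weight j p s) tails (filterᵇ isOdd (map suc (upTo (suc n)))) ⟩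
    sumℤ (map G (filterᵇ isOdd (map suc (upTo (suc n)))))
      ≡⟨ sumℤ-filterᵇ isOdd G (map suc (upTo (suc n))) ⟩
    sumℤ (map (λ k → if isOdd k then G k else + 0) (map suc (upTo (suc n))))
      ≡⟨ cong sumℤ (ListP.map-∘ {g = λ k → if isOdd k then G k else + 0} {f = suc} (upTo (suc n))) ⟨
    sumℤ (map (λ i → if isOdd (suc i) then G (suc i) else + 0) (upTo (suc n)))
      ≡⟨ sumℤ-applyUpTo (λ i → if isOdd (suc i) then G (suc i) else + 0) id (suc n) ⟩
    sumTo (suc n) (λ i → if isOdd (suc i) then G (suc i) else + 0)
      ≡⟨ sumTo-cong (suc n) (λ i → cong (λ x → if isOdd (suc i) then x else + 0) (G-suc i)) ⟩
    _ ∎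
    where
    open ≡-Reasoning
    tails : ℕ → List (List ℕ)
    tails k = map (k ∷_) (oddCompsF f (suc n ∸ k))
    G : ℕ → ℤ
    G k = sumℤ (map (weight j p s) (tails k))
    G-suc : ∀ i → G (suc i) ≡ shift (σ N (p ℕ.+ suc i)) (seriesWithFuel f (suc j) (p ℕ.+ suc i) (n ∸ i)) s
    G-suc i = begin
      sumℤ (map (weight j p s) (map (suc i ∷_) (oddCompsF f (n ∸ i))))
        ≡⟨ cong sumℤ (ListP.map-∘ {g = weight j p s} {f = suc i ∷_} (oddCompsF f (n ∸ i))) ⟨
      sumℤ (map (weight j p s ∘ (suc i ∷_)) (oddCompsF f (n ∸ i)))
        ≡⟨ sumℤ-cong (weight-∷ j p s (suc i)) (oddCompsF f (n ∸ i)) ⟩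
      sumℤ (map (λ α → shift (σ N (p ℕ.+ suc i)) (λ s′ → weight (suc j) (p ℕ.+ suc i) s′ α) s) (oddCompsF f (n ∸ i)))
        ≡⟨ shift-sumℤ (σ N (p ℕ.+ suc i)) (λ α s′ → weight (suc j) (p ℕ.+ suc i) s′ α) (oddCompsF f (n ∸ i)) s ⟨
      shift (σ N (p ℕ.+ suc i)) (seriesWithFuel f (suc j) (p ℕ.+ suc i) (n ∸ i)) s ∎

  seriesWithFuel-irrelevant : ∀ f g {n} → n ℕ.≤ f → n ℕ.≤ g → ∀ j p s →
    seriesWithFuel f j p n s ≡ seriesWithFuel g j p n s
  seriesWithFuel-irrelevant f       g       {zero}  _           _           j p s = refl
  seriesWithFuel-irrelevant (suc f) (suc g) {suc n} (s≤s n≤f) (s≤s n≤g) j p s = begin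
    seriesWithFuel (suc f) j p (suc n) s ≡⟨ seriesWithFuel-suc f j p n s ⟩
    sumTo (suc n) (term f)               ≡⟨ sumTo-cong (suc n) term-f≗term-g ⟩
    sumTo (suc n) (term g)               ≡⟨ seriesWithFuel-suc g j p n s ⟨
    seriesWithFuel (suc g) j p (suc n) s ∎
    where
    open ≡-Reasoning
    term : ℕ → ℕ → ℤ
    term f i = if isOdd (suc i)
               then shift (σ N (p ℕ.+ suc i)) (seriesWithFuel f (suc j) (p ℕ.+ suc i) (n ∸ i)) s
               else + 0
    term-f≗term-g : term f ≗ term g
    term-f≗term-g i = cong (λ x → if isOdd (suc i) then x else + 0)
      (shift-cong (σ N (p ℕ.+ suc i))
        (seriesWithFuel-irrelevant f g (ℕP.≤-trans (ℕP.m∸n≤m n i) n≤f) (ℕP.≤-trans (ℕP.m∸n≤m n i) n≤g)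
                                   (suc j) (p ℕ.+ suc i)) s)

  series : ℕ → ℕ → ℕ → ℕ → ℤ
  series j p n = seriesWithFuel n j p n

  series-suc : ∀ j p n s → series j p (suc n) s ≡
    sumTo (suc n) (λ i → if isOdd (suc i)
                         then shift (σ N (p ℕ.+ suc i)) (series (suc j) (p ℕ.+ suc i) (n ∸ i)) s
                         else + 0)
  series-suc j p n s = trans (seriesWithFuel-suc n j p n s) (sumTo-cong (suc n) λ i →
    cong (λ x → if isOdd (suc i) then x else + 0)
      (shift-cong (σ N (p ℕ.+ suc i))
        (seriesWithFuel-irrelevant n (n ∸ i) (ℕP.m∸n≤m n i) ℕP.≤-refl (suc j) (p ℕ.+ suc i)) s))

  -- Odd compositions of n whose first part is at least 3 are the odd compositions of n ∸ 2
  -- with that part lowered by 2, started two positions later.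
  longFirstPart : ℕ → ℕ → ℕ → ℕ → ℤ
  longFirstPart j p (suc (suc (suc n))) s = series j (suc (suc p)) (suc n) s
  longFirstPart j p _                   s = + 0

  series-firstPart : ∀ j p n s → series j p (suc n) s ≡
    shift (σ N (suc p)) (series (suc j) (suc p) n) s + longFirstPart j p (suc n) s
  series-firstPart j p n s = trans (series-suc j p n s)
    (cong₂ _+_ (cong (λ q → shift (σ N q) (series (suc j) q n) s) (ℕP.+-comm p 1)) (longParts n))
    where
    longParts : ∀ n → sumTo n (λ i → if isOdd (suc (suc i))
                                     then shift (σ N (p ℕ.+ suc (suc i))) (series (suc j) (p ℕ.+ suc (suc i)) (n ∸ suc i)) s
                                     else + 0)
                      ≡ longFirstPart j p (suc n) s
    longParts zero                = refl
    longParts (suc zero)          = refl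
    longParts (suc (suc n)) = trans (ℤP.+-identityˡ _)
      (trans (sumTo-cong (suc n) samePart) (sym (series-suc j (suc (suc p)) n s)))
      where
      samePart : ∀ i →
        (if isOdd (suc (suc (suc i)))
         then shift (σ N (p ℕ.+ suc (suc (suc i)))) (series (suc j) (p ℕ.+ suc (suc (suc i))) (n ∸ i)) s
         else + 0)
        ≡ (if isOdd (suc i)
           then shift (σ N (suc (suc p) ℕ.+ suc i)) (series (suc j) (suc (suc p) ℕ.+ suc i) (n ∸ i)) s
           else + 0)
      samePart i rewrite isOdd-+2 (suc i) | ℕP.+-suc p (suc (suc i)) | ℕP.+-suc p (suc i) = refl

  seriesUpTo : ℕ → ℕ → ℕ → ℕ → ℤ
  seriesUpTo j p K s = sumTo (suc K) (λ n → series j p n s)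

  seriesUpTo-suc : ∀ j p K s → seriesUpTo j p (suc K) s ≡
    seriesUpTo j (suc (suc p)) (K ∸ 1) s + shift (σ N (suc p)) (seriesUpTo (suc j) (suc p) K) s
  seriesUpTo-suc j p K s = begin
    empty + sumTo (suc K) (λ n → series j p (suc n) s)
      ≡⟨ cong (_+_ empty) (sumTo-cong (suc K) (λ n → series-firstPart j p n s)) ⟩
    empty + sumTo (suc K) (λ n → shift σ₁ (series (suc j) (suc p) n) s + longFirstPart j p (suc n) s)
      ≡⟨ cong (_+_ empty) (sumTo-+ (suc K) (λ n → shift σ₁ (series (suc j) (suc p) n) s) (λ n → longFirstPart j p (suc n) s)) ⟩
    empty + (sumTo (suc K) (λ n → shift σ₁ (series (suc j) (suc p) n) s) + sumTo (suc K) (λ n → longFirstPart j p (suc n) s))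
      ≡⟨ cong₂ (λ x y → empty + (x + y)) (shift-sumTo σ₁ (suc K) (series (suc j) (suc p)) s) (long K) ⟨
    empty + (shift σ₁ (seriesUpTo (suc j) (suc p) K) s + sumTo (K ∸ 1) (λ n → series j (suc (suc p)) (suc n) s))
      ≡⟨ swap empty _ _ ⟩
    empty + sumTo (K ∸ 1) (λ n → series j (suc (suc p)) (suc n) s) + shift σ₁ (seriesUpTo (suc j) (suc p) K) s ∎
    where
    open ≡-Reasoning
    σ₁ = σ N (suc p)
    empty = series j p 0 s
    swap : ∀ a b c → a + (b + c) ≡ a + c + b
    swap = solve-∀
    long : ∀ K → sumTo (K ∸ 1) (λ n → series j (suc (suc p)) (suc n) s)
               ≡ sumTo (suc K) (λ n → longFirstPart j p (suc n) s)
    long zero    = refl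
    long (suc K) = sym (trans (ℤP.+-identityˡ _) (ℤP.+-identityˡ _))

  -- The odd compositions α with p + |α| ≤ N, i.e. the tails after partial sum p of the elements of OC≤ N.
  tailSeries : ℕ → ℕ → ℕ → ℤ
  tailSeries j p = seriesUpTo j p (N ∸ p)

  tailSeries-rec : ∀ j p s → p ℕ.< N →
    tailSeries j p s ≡ tailSeries j (suc (suc p)) s + shift (σ N (suc p)) (tailSeries (suc j) (suc p)) s
  tailSeries-rec j p s p<N = begin
    seriesUpTo j p (N ∸ p) s
      ≡⟨ cong (λ K → seriesUpTo j p K s) (∸≡suc∸suc p<N) ⟩
    seriesUpTo j p (suc (N ∸ suc p)) s
      ≡⟨ seriesUpTo-suc j p (N ∸ suc p) s ⟩
    seriesUpTo j (suc (suc p)) (N ∸ suc p ∸ 1) s + shift (σ N (suc p)) (tailSeries (suc j) (suc p)) s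
      ≡⟨ cong (λ K → seriesUpTo j (suc (suc p)) K s + shift (σ N (suc p)) (tailSeries (suc j) (suc p)) s)
              (trans (ℕP.∸-+-assoc N (suc p) 1) (cong (N ∸_) (ℕP.+-comm (suc p) 1))) ⟩
    tailSeries j (suc (suc p)) s + shift (σ N (suc p)) (tailSeries (suc j) (suc p)) s ∎
    where open ≡-Reasoning

  tailSeries-≥ : ∀ j p s → N ℕ.≤ p → tailSeries j p s ≡ series j p 0 s + + 0
  tailSeries-≥ j p s N≤p rewrite ℕP.m≤n⇒m∸n≡0 N≤p = refl

  weight-+2 : ∀ j p s α → weight (suc (suc j)) p s α ≡ - weight j p s α
  weight-+2 j p s α with S-acc N p α ≡ᵇ s
  ... | true  = trans (cong sgn ([2+m]/2 (j ℕ.+ length α ℕ.+ 1))) (sgn-suc ((j ℕ.+ length α ℕ.+ 1) / 2))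
  ... | false = refl

  tailSeries-+2 : ∀ j p s → tailSeries (suc (suc j)) p s ≡ - tailSeries j p s
  tailSeries-+2 j p s = trans (sumTo-cong (suc (N ∸ p)) series-+2) (sumTo-neg (suc (N ∸ p)) (λ n → series j p n s))
    where
    series-+2 : ∀ n → series (suc (suc j)) p n s ≡ - series j p n s
    series-+2 n = trans (sumℤ-cong (weight-+2 j p s) (oddCompsF n n)) (sumℤ-neg (weight j p s) (oddCompsF n n))

  -- A c and B a are the tails after an even partial sum 2c, resp. an odd one 2a+1, normalised by
  -- the sign the parity of the number of parts forces.
  A : ℕ → ℕ → ℤ
  A c = tailSeries 0 (c ℕ.+ c)

  B : ℕ → ℕ → ℤ
  B a s = - tailSeries 1 (suc (a ℕ.+ a)) s

  A-rec : ∀ c s → suc (c ℕ.+ c) ℕ.≤ N → A c s ≡ A (suc c) s - shift (N ∸ c) (B c) s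
  A-rec c s 2c<N = begin
    tailSeries 0 (c ℕ.+ c) s
      ≡⟨ tailSeries-rec 0 (c ℕ.+ c) s 2c<N ⟩
    tailSeries 0 (suc (suc (c ℕ.+ c))) s + shift (σ N (suc (c ℕ.+ c))) (tailSeries 1 (suc (c ℕ.+ c))) s
      ≡⟨ cong₂ (λ q k → tailSeries 0 q s + shift k (tailSeries 1 (suc (c ℕ.+ c))) s)
               (sym (cong suc (ℕP.+-suc c c))) (σ-suc-double N c) ⟩
    A (suc c) s + shift (N ∸ c) (tailSeries 1 (suc (c ℕ.+ c))) s
      ≡⟨ cong (_+_ (A (suc c) s)) (shift-cong (N ∸ c) (λ x → sym (ℤP.neg-involutive _)) s) ⟩
    A (suc c) s + shift (N ∸ c) (λ x → - B c x) s
      ≡⟨ cong (_+_ (A (suc c) s)) (shift-neg (N ∸ c) (B c) s) ⟩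
    A (suc c) s - shift (N ∸ c) (B c) s ∎
    where open ≡-Reasoning

  B-rec : ∀ a s → suc (suc (a ℕ.+ a)) ℕ.≤ N → B a s ≡ B (suc a) s + shift (suc a) (A (suc a)) s
  B-rec a s 2a+1<N = begin
    - tailSeries 1 p s
      ≡⟨ cong -_ (tailSeries-rec 1 p s 2a+1<N) ⟩
    - (tailSeries 1 (suc (suc p)) s + shift (σ N (suc p)) (tailSeries 2 (suc p)) s)
      ≡⟨ ℤP.neg-distrib-+ (tailSeries 1 (suc (suc p)) s) _ ⟩
    - tailSeries 1 (suc (suc p)) s + - shift (σ N (suc p)) (tailSeries 2 (suc p)) s
      ≡⟨ cong₂ (λ q x → - tailSeries 1 (suc q) s + x) (cong suc (ℕP.+-suc a a)) (shift-neg (σ N (suc p)) _ s) ⟨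
    B (suc a) s + shift (σ N (suc p)) (λ x → - tailSeries 2 (suc p) x) s
      ≡⟨ cong (_+_ (B (suc a) s)) (shift-cong (σ N (suc p)) tailSeries-2≗A s) ⟩
    B (suc a) s + shift (σ N (suc p)) (A (suc a)) s
      ≡⟨ cong (λ k → B (suc a) s + shift k (A (suc a)) s) (trans (cong (σ N) (sym (cong suc (ℕP.+-suc a a)))) (σ-double N (suc a))) ⟩
    B (suc a) s + shift (suc a) (A (suc a)) s ∎
    where
    open ≡-Reasoning
    p = suc (a ℕ.+ a)
    tailSeries-2≗A : ∀ x → - tailSeries 2 (suc p) x ≡ A (suc a) x
    tailSeries-2≗A x = begin
      - tailSeries 2 (suc p) x     ≡⟨ cong -_ (tailSeries-+2 0 (suc p) x) ⟩
      - - tailSeries 0 (suc p) x   ≡⟨ ℤP.neg-involutive _ ⟩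
      tailSeries 0 (suc p) x       ≡⟨ cong (λ q → tailSeries 0 q x) (cong suc (ℕP.+-suc a a)) ⟨
      A (suc a) x                  ∎

  A-≥ : ∀ c s → N ℕ.≤ c ℕ.+ c → A c s ≡ δ s
  A-≥ c zero    N≤2c = tailSeries-≥ 0 (c ℕ.+ c) 0 N≤2c
  A-≥ c (suc s) N≤2c = tailSeries-≥ 0 (c ℕ.+ c) (suc s) N≤2c

  B-≥ : ∀ a s → N ℕ.≤ suc (a ℕ.+ a) → B a s ≡ δ s
  B-≥ a zero    N≤2a+1 = cong -_ (tailSeries-≥ 1 (suc (a ℕ.+ a)) 0 N≤2a+1)
  B-≥ a (suc s) N≤2a+1 = cong -_ (tailSeries-≥ 1 (suc (a ℕ.+ a)) (suc s) N≤2a+1)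

  coeffφ≡A0 : ∀ s → coeffφ N s ≡ A 0 s
  coeffφ≡A0 s = trans (sumℤ-concatMap indicator oddComps (upTo (suc N)))
                      (sumℤ-applyUpTo (λ n → sumℤ (map indicator (oddComps n))) id (suc N))
    where
    indicator : List ℕ → ℤ
    indicator α = if S N α ≡ᵇ s then signOC α else + 0

module ClosedForm (N′ h : ℕ) (2h≤N : h ℕ.+ h ℕ.≤ suc N′) (N≤2h+1 : suc N′ ℕ.≤ suc (h ℕ.+ h)) where

  open import Data.Integer using (_+_; _-_; _*_; -_)

  N : ℕ
  N = suc N′

  -- The coefficients of x^((m+1)N + D) and x^(m(N+1) + r) in the closed form of A c, and of
  -- x^(mN + E) and x^(m(N+1) + r) in that of B a.
  evenA : ℕ → ℕ → ℕ → ℤ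
  evenA c m D = sgn (suc m) * choose (+ D - + 1) m * choose (+ h - + c - + D + + m + + 1) (suc m)

  oddA : ℕ → ℕ → ℕ → ℤ
  oddA c m r = sgn (suc m) * choose (+ m + + r - + h - + 1) m * choose (+ N - + r - + c) m

  evenB : ℕ → ℕ → ℕ → ℤ
  evenB a m E = sgn m * choose (+ E - + a - + 1) m * choose (+ h - + E + + m) m

  oddB : ℕ → ℕ → ℕ → ℤ
  oddB a m r = sgn (suc m) * choose (+ m + + r - + h - + 1 - + a) (suc m) * choose (+ N - + r) m

  closedA : ℕ → ℕ → ℤ
  closedA c s = δ s + (sumTo N (λ m → shift (suc m ℕ.* N) (evenA c m) s)
                       + sumTo (suc N) (λ m → shift (m ℕ.* suc N) (oddA c m) s))

  closedB : ℕ → ℕ → ℤ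
  closedB a s = δ s + (sumTo N (λ m → shift (m ℕ.* N) (evenB a m) s)
                       + sumTo N (λ m → shift (m ℕ.* suc N) (oddB a m) s))

  evenA-zeroˡ : ∀ c m D → choose (+ D - + 1) m ≡ + 0 → evenA c m D ≡ + 0
  evenA-zeroˡ c m D = middle≡0⇒product≡0 (sgn (suc m)) (choose (+ h - + c - + D + + m + + 1) (suc m))

  evenA-zeroʳ : ∀ c m D → choose (+ h - + c - + D + + m + + 1) (suc m) ≡ + 0 → evenA c m D ≡ + 0
  evenA-zeroʳ c m D = last≡0⇒product≡0 (sgn (suc m)) (choose (+ D - + 1) m)

  oddA-zeroˡ : ∀ c m r → choose (+ m + + r - + h - + 1) m ≡ + 0 → oddA c m r ≡ + 0
  oddA-zeroˡ c m r = middle≡0⇒product≡0 (sgn (suc m)) (choose (+ N - + r - + c) m)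

  oddA-zeroʳ : ∀ c m r → choose (+ N - + r - + c) m ≡ + 0 → oddA c m r ≡ + 0
  oddA-zeroʳ c m r = last≡0⇒product≡0 (sgn (suc m)) (choose (+ m + + r - + h - + 1) m)

  evenB-zeroˡ : ∀ a m E → choose (+ E - + a - + 1) m ≡ + 0 → evenB a m E ≡ + 0
  evenB-zeroˡ a m E = middle≡0⇒product≡0 (sgn m) (choose (+ h - + E + + m) m)

  evenB-zeroʳ : ∀ a m E → choose (+ h - + E + + m) m ≡ + 0 → evenB a m E ≡ + 0
  evenB-zeroʳ a m E = last≡0⇒product≡0 (sgn m) (choose (+ E - + a - + 1) m)

  oddB-zeroˡ : ∀ a m r → choose (+ m + + r - + h - + 1 - + a) (suc m) ≡ + 0 → oddB a m r ≡ + 0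
  oddB-zeroˡ a m r = middle≡0⇒product≡0 (sgn (suc m)) (choose (+ N - + r) m)

  oddB-zeroʳ : ∀ a m r → choose (+ N - + r) m ≡ + 0 → oddB a m r ≡ + 0
  oddB-zeroʳ a m r = last≡0⇒product≡0 (sgn (suc m)) (choose (+ m + + r - + h - + 1 - + a) (suc m))

  evenB-below : ∀ a m {E} → E ℕ.≤ a → evenB a m E ≡ + 0
  evenB-below a m {E} E≤a = evenB-zeroˡ a m E (choose-vanishes E (suc a) (idx (+ E) (+ a)) (ℕP.m≤n⇒m≤o+n m (s≤s E≤a)))
    where
    idx : ∀ e a → e - a - + 1 ≡ e - (+ 1 + a)
    idx = solve-∀

  oddB-below : ∀ a m {r} → r ℕ.≤ h ℕ.+ 1 ℕ.+ a → oddB a m r ≡ + 0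
  oddB-below a m {r} r≤h+1+a = oddB-zeroˡ a m r
    (choose-vanishes (m ℕ.+ r) (h ℕ.+ 1 ℕ.+ a) (idx (+ m) (+ r) (+ h) (+ a)) (s≤s (ℕP.+-monoʳ-≤ m r≤h+1+a)))
    where
    idx : ∀ m r h a → m + r - h - + 1 - a ≡ m + r - (h + + 1 + a)
    idx = solve-∀

  cancel-negated : ∀ ε p a b → - ε * p * (a + b) - - ε * p * b ≡ - (ε * p * a)
  cancel-negated = solve-∀

  cancel : ∀ ε u v q → ε * (u + v) * q - ε * v * q ≡ ε * u * q
  cancel = solve-∀

  evenA-diff : ∀ c m → shift c (λ D → evenA c m D - evenA (suc c) m D) ≗ (λ E → - evenB c m E)
  evenA-diff c m = shift-≗ c pascal below
    where
    below : ∀ E → E ℕ.< c → - evenB c m E ≡ + 0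
    below E E<c = cong -_ (evenB-below c m (ℕP.<⇒≤ E<c))
    pascal : ∀ d → evenA c m d - evenA (suc c) m d ≡ - evenB c m (c ℕ.+ d)
    pascal d = begin
      sgn (suc m) * P * choose (+ h - + c - + d + + m + + 1) (suc m) - sgn (suc m) * P * choose x (suc m)
        ≡⟨ cong (λ y → sgn (suc m) * P * choose y (suc m) - sgn (suc m) * P * choose x (suc m))
                (upper (+ h) (+ c) (+ d) (+ m)) ⟩
      sgn (suc m) * P * choose (x + + 1) (suc m) - sgn (suc m) * P * choose x (suc m)
        ≡⟨ cong₂ (λ ε y → ε * P * y - ε * P * choose x (suc m)) (sgn-suc m) (choose-pascal x m) ⟩
      - sgn m * P * (choose x m + choose x (suc m)) - - sgn m * P * choose x (suc m)
        ≡⟨ cancel-negated (sgn m) P (choose x m) (choose x (suc m)) ⟩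
      - (sgn m * P * choose x m)
        ≡⟨ cong₂ (λ y z → - (sgn m * choose y m * choose z m)) (lower (+ c) (+ d)) (upper′ (+ h) (+ c) (+ d) (+ m)) ⟩
      - evenB c m (c ℕ.+ d) ∎
      where
      open ≡-Reasoning
      P = choose (+ d - + 1) m
      x = + h - (+ 1 + + c) - + d + + m + + 1
      upper : ∀ h c d m → h - c - d + m + + 1 ≡ h - (+ 1 + c) - d + m + + 1 + + 1
      upper = solve-∀
      lower : ∀ c d → d - + 1 ≡ c + d - c - + 1
      lower = solve-∀
      upper′ : ∀ h c d m → h - (+ 1 + c) - d + m + + 1 ≡ h - (c + d) + m
      upper′ = solve-∀

  oddA-diff : ∀ c m → shift (suc c) (λ r → oddA c (suc m) r - oddA (suc c) (suc m) r) ≗ (λ r → - oddB c m r)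
  oddA-diff c m = shift-≗ (suc c) pascal below
    where
    below : ∀ r → r ℕ.< suc c → - oddB c m r ≡ + 0
    below r (s≤s r≤c) = cong -_ (oddB-below c m (ℕP.m≤n⇒m≤o+n (h ℕ.+ 1) r≤c))
    pascal : ∀ d → oddA c (suc m) d - oddA (suc c) (suc m) d ≡ - oddB c m (suc c ℕ.+ d)
    pascal d = begin
      ε * P * choose (+ N - + d - + c) (suc m) - ε * P * choose (+ N - + d - (+ 1 + + c)) (suc m)
        ≡⟨ cong₂ (λ u v → ε * P * choose u (suc m) - ε * P * choose v (suc m))
                 (upper (+ N) (+ d) (+ c)) (upper′ (+ N) (+ d) (+ c)) ⟩
      ε * P * choose (y + + 1) (suc m) - ε * P * choose y (suc m)
        ≡⟨ cong₂ (λ ε′ z → ε′ * P * z - ε′ * P * choose y (suc m)) (sgn-suc (suc m)) (choose-pascal y m) ⟩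
      - sgn (suc m) * P * (choose y m + choose y (suc m)) - - sgn (suc m) * P * choose y (suc m)
        ≡⟨ cancel-negated (sgn (suc m)) P (choose y m) (choose y (suc m)) ⟩
      - (sgn (suc m) * P * choose y m)
        ≡⟨ cong₂ (λ u v → - (sgn (suc m) * choose u (suc m) * choose v m))
                 (lower (+ m) (+ c) (+ d) (+ h)) (upper″ (+ N) (+ c) (+ d)) ⟩
      - oddB c m (suc c ℕ.+ d) ∎
      where
      open ≡-Reasoning
      ε = sgn (suc (suc m))
      P = choose (+ 1 + + m + + d - + h - + 1) (suc m)
      y = + N - + d - + c - + 1
      upper : ∀ n d c → n - d - c ≡ n - d - c - + 1 + + 1
      upper = solve-∀
      upper′ : ∀ n d c → n - d - (+ 1 + c) ≡ n - d - c - + 1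
      upper′ = solve-∀
      lower : ∀ m c d h → + 1 + m + d - h - + 1 ≡ m + (+ 1 + (c + d)) - h - + 1 - c
      lower = solve-∀
      upper″ : ∀ n c d → n - d - c - + 1 ≡ n - (+ 1 + (c + d))
      upper″ = solve-∀

  evenB-diff : ∀ a m → shift (suc a) (evenA (suc a) m) ≗ (λ E → evenB a (suc m) E - evenB (suc a) (suc m) E)
  evenB-diff a m = shift-≗ (suc a) pascal below
    where
    below : ∀ E → E ℕ.< suc a → evenB a (suc m) E - evenB (suc a) (suc m) E ≡ + 0
    below E (s≤s E≤a) = cong₂ _-_ (evenB-below a (suc m) E≤a) (evenB-below (suc a) (suc m) (ℕP.m≤n⇒m≤1+n E≤a))
    pascal : ∀ d → evenA (suc a) m d ≡ evenB a (suc m) (suc a ℕ.+ d) - evenB (suc a) (suc m) (suc a ℕ.+ d)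
    pascal d = sym (begin
      ε * choose (+ (suc a ℕ.+ d) - + a - + 1) (suc m) * Q - ε * choose (+ (suc a ℕ.+ d) - + suc a - + 1) (suc m) * Q
        ≡⟨ cong₂ (λ u v → ε * choose u (suc m) * Q - ε * choose v (suc m) * Q) (upper (+ a) (+ d)) (lower (+ a) (+ d)) ⟩
      ε * choose (x + + 1) (suc m) * Q - ε * choose x (suc m) * Q
        ≡⟨ cong (λ z → ε * z * Q - ε * choose x (suc m) * Q) (choose-pascal x m) ⟩
      ε * (choose x m + choose x (suc m)) * Q - ε * choose x (suc m) * Q
        ≡⟨ cancel ε (choose x m) (choose x (suc m)) Q ⟩
      ε * choose x m * Q
        ≡⟨ cong (λ z → ε * choose x m * choose z (suc m)) (top (+ h) (+ a) (+ d) (+ m)) ⟩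
      evenA (suc a) m d ∎)
      where
      open ≡-Reasoning
      ε = sgn (suc m)
      Q = choose (+ h - + (suc a ℕ.+ d) + + suc m) (suc m)
      x = + d - + 1
      upper : ∀ a d → + 1 + (a + d) - a - + 1 ≡ d - + 1 + + 1
      upper = solve-∀
      lower : ∀ a d → + 1 + (a + d) - (+ 1 + a) - + 1 ≡ d - + 1
      lower = solve-∀
      top : ∀ h a d m → h - (+ 1 + (a + d)) + (+ 1 + m) ≡ h - (+ 1 + a) - d + m + + 1
      top = solve-∀

  oddB-diff : ∀ a m → shift (suc a) (oddA (suc a) m) ≗ (λ r → oddB a m r - oddB (suc a) m r)
  oddB-diff a m = shift-≗ (suc a) pascal below
    where
    below : ∀ r → r ℕ.< suc a → oddB a m r - oddB (suc a) m r ≡ + 0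
    below r (s≤s r≤a) = cong₂ _-_ (oddB-below a m (ℕP.m≤n⇒m≤o+n (h ℕ.+ 1) r≤a))
                                  (oddB-below (suc a) m (ℕP.m≤n⇒m≤o+n (h ℕ.+ 1) (ℕP.m≤n⇒m≤1+n r≤a)))
    pascal : ∀ d → oddA (suc a) m d ≡ oddB a m (suc a ℕ.+ d) - oddB (suc a) m (suc a ℕ.+ d)
    pascal d = sym (begin
      ε * choose (+ m + + (suc a ℕ.+ d) - + h - + 1 - + a) (suc m) * W
        - ε * choose (+ m + + (suc a ℕ.+ d) - + h - + 1 - + suc a) (suc m) * W
        ≡⟨ cong₂ (λ u v → ε * choose u (suc m) * W - ε * choose v (suc m) * W)
                 (upper (+ m) (+ a) (+ d) (+ h)) (lower (+ m) (+ a) (+ d) (+ h)) ⟩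
      ε * choose (y + + 1) (suc m) * W - ε * choose y (suc m) * W
        ≡⟨ cong (λ z → ε * z * W - ε * choose y (suc m) * W) (choose-pascal y m) ⟩
      ε * (choose y m + choose y (suc m)) * W - ε * choose y (suc m) * W
        ≡⟨ cancel ε (choose y m) (choose y (suc m)) W ⟩
      ε * choose y m * W
        ≡⟨ cong (λ z → ε * choose y m * choose z m) (top (+ N) (+ a) (+ d)) ⟩
      oddA (suc a) m d ∎)
      where
      open ≡-Reasoning
      ε = sgn (suc m)
      W = choose (+ N - + (suc a ℕ.+ d)) m
      y = + m + + d - + h - + 1
      upper : ∀ m a d h → m + (+ 1 + (a + d)) - h - + 1 - a ≡ m + d - h - + 1 + + 1
      upper = solve-∀
      lower : ∀ m a d h → m + (+ 1 + (a + d)) - h - + 1 - (+ 1 + a) ≡ m + d - h - + 1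
      lower = solve-∀
      top : ∀ n a d → n - (+ 1 + (a + d)) ≡ n - d - (+ 1 + a)
      top = solve-∀

  c+h<N : ∀ {c} → suc (c ℕ.+ c) ℕ.≤ N → c ℕ.+ h ℕ.< N
  c+h<N {c} 2c<N = ℕP.≰⇒> λ N≤c+h → ℕP.<-irrefl refl (begin-strict
    N ℕ.+ N                 ≤⟨ ℕP.+-mono-≤ N≤c+h N≤c+h ⟩
    c ℕ.+ h ℕ.+ (c ℕ.+ h)   ≡⟨ interchange c h ⟩
    c ℕ.+ c ℕ.+ (h ℕ.+ h)   <⟨ ℕP.+-mono-<-≤ 2c<N 2h≤N ⟩
    N ℕ.+ N                 ∎)
    where
    open ℕP.≤-Reasoning
    interchange : ∀ a b → a ℕ.+ b ℕ.+ (a ℕ.+ b) ≡ a ℕ.+ a ℕ.+ (b ℕ.+ b)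
    interchange = ℕSolver.solve-∀

  oddA-zero-diff : ∀ c → suc (c ℕ.+ c) ℕ.≤ N → shift (N ∸ c) δ ≗ (λ r → oddA (suc c) 0 r - oddA c 0 r)
  oddA-zero-diff c 2c<N = shift-≗ K at below
    where
    K = N ∸ c
    K+c≡N : K ℕ.+ c ≡ N
    K+c≡N = ℕP.m∸n+n≡m (ℕP.≤-trans (ℕP.m≤m+n c c) (ℕP.<⇒≤ 2c<N))
    h<K : h ℕ.< K
    h<K = ℕP.+-cancelʳ-< c h K (subst (h ℕ.+ c ℕ.<_) (sym K+c≡N) (subst (ℕ._< N) (ℕP.+-comm c h) (c+h<N 2c<N)))
    below : ∀ r → r ℕ.< K → oddA (suc c) 0 r - oddA c 0 r ≡ + 0
    below r r<K = trans
      (cong₂ (λ u v → sgn 1 * Q * u - sgn 1 * Q * v)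
             (choose-0≡1 N (suc (r ℕ.+ c)) (idx₁ (+ N) (+ r) (+ c)) r+c<N)
             (choose-0≡1 N (r ℕ.+ c) (idx₂ (+ N) (+ r) (+ c)) (ℕP.<⇒≤ r+c<N)))
      (ℤP.+-inverseʳ (sgn 1 * Q * + 1))
      where
      Q = choose (+ 0 + + r - + h - + 1) 0
      r+c<N : r ℕ.+ c ℕ.< N
      r+c<N = subst (r ℕ.+ c ℕ.<_) K+c≡N (ℕP.+-monoˡ-< c r<K)
      idx₁ : ∀ n r c → n - r - (+ 1 + c) ≡ n - (+ 1 + (r + c))
      idx₁ = solve-∀
      idx₂ : ∀ n r c → n - r - c ≡ n - (r + c)
      idx₂ = solve-∀
    at : ∀ d → δ d ≡ oddA (suc c) 0 (K ℕ.+ d) - oddA c 0 (K ℕ.+ d)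
    at d = sym (begin
      sgn 1 * Q * choose (+ N - + (K ℕ.+ d) - (+ 1 + + c)) 0 - sgn 1 * Q * choose (+ N - + (K ℕ.+ d) - + c) 0
        ≡⟨ cong₂ (λ u v → sgn 1 * Q * u - sgn 1 * Q * v) past edge ⟩
      sgn 1 * Q * + 0 - sgn 1 * Q * δ d
        ≡⟨ cong (λ q → sgn 1 * q * + 0 - sgn 1 * q * δ d)
                (choose-0≡1 (K ℕ.+ d) (suc h) (idxQ (+ (K ℕ.+ d)) (+ h)) (ℕP.m≤n⇒m≤n+o d h<K)) ⟩
      sgn 1 * + 1 * + 0 - sgn 1 * + 1 * δ d
        ≡⟨ collapse d ⟩
      δ d ∎)
      where
      open ≡-Reasoning
      Q = choose (+ 0 + + (K ℕ.+ d) - + h - + 1) 0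
      idxQ : ∀ k h → + 0 + k - h - + 1 ≡ k - (+ 1 + h)
      idxQ = solve-∀
      idxN : ∀ k c d → k + c - (k + d) - (+ 1 + c) ≡ k + c - (k + d + (+ 1 + c))
      idxN = solve-∀
      past : choose (+ N - + (K ℕ.+ d) - (+ 1 + + c)) 0 ≡ + 0
      past = choose-vanishes N (K ℕ.+ d ℕ.+ suc c)
        (subst (λ n → + n - + (K ℕ.+ d) - (+ 1 + + c) ≡ + n - + (K ℕ.+ d ℕ.+ suc c)) K+c≡N (idxN (+ K) (+ c) (+ d)))
        (subst (ℕ._< K ℕ.+ d ℕ.+ suc c) K+c≡N (ℕP.+-mono-≤-< (ℕP.m≤m+n K d) (ℕP.n<1+n c)))
      idxE : ∀ k c d → k + c - (k + d) - c ≡ + 0 - d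
      idxE = solve-∀
      choose-−0 : ∀ d → choose (+ 0 - + d) 0 ≡ δ d
      choose-−0 zero    = refl
      choose-−0 (suc d) = refl
      edge : choose (+ N - + (K ℕ.+ d) - + c) 0 ≡ δ d
      edge = trans (cong (λ n → choose (+ n - + (K ℕ.+ d) - + c) 0) (sym K+c≡N))
                   (trans (cong (λ z → choose z 0) (idxE (+ K) (+ c) (+ d))) (choose-−0 d))
      collapse : ∀ d → sgn 1 * + 1 * + 0 - sgn 1 * + 1 * δ d ≡ δ d
      collapse zero    = refl
      collapse (suc d) = refl

  evenB-zero-diff : ∀ a → suc a ℕ.≤ h → shift (suc a) δ ≗ (λ E → evenB a 0 E - evenB (suc a) 0 E)
  evenB-zero-diff a a<h = shift-≗ (suc a) at below
    where
    below : ∀ E → E ℕ.< suc a → evenB a 0 E - evenB (suc a) 0 E ≡ + 0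
    below E (s≤s E≤a) = cong₂ _-_ (evenB-below a 0 E≤a) (evenB-below (suc a) 0 (ℕP.m≤n⇒m≤1+n E≤a))
    Q : ℕ → ℤ
    Q d = choose (+ h - + (suc a ℕ.+ d) + + 0) 0
    idx : ∀ a d → + 1 + (a + d) - a - + 1 ≡ d - + 0
    idx = solve-∀
    at : ∀ d → δ d ≡ evenB a 0 (suc a ℕ.+ d) - evenB (suc a) 0 (suc a ℕ.+ d)
    at d = sym (trans (cong (λ u → + 1 * u * Q d - + 1 * choose (+ (suc a ℕ.+ d) - + suc a - + 1) 0 * Q d)
                            (choose-0≡1 d 0 (idx (+ a) (+ d)) z≤n))
                      (collapse d))
      where
      idxQ : ∀ h a → h - (+ 1 + (a + + 0)) + + 0 ≡ h - (+ 1 + a)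
      idxQ = solve-∀
      idxL : ∀ a d → + 1 + (a + d) - (+ 1 + a) - + 1 ≡ d - + 1
      idxL = solve-∀
      collapse : ∀ d → + 1 * + 1 * Q d - + 1 * choose (+ (suc a ℕ.+ d) - + suc a - + 1) 0 * Q d ≡ δ d
      collapse zero = begin
        + 1 * + 1 * Q 0 - + 1 * choose (+ (suc a ℕ.+ 0) - + suc a - + 1) 0 * Q 0
          ≡⟨ cong (λ u → + 1 * + 1 * Q 0 - + 1 * u * Q 0)
                  (choose-vanishes 0 1 (idxL (+ a) (+ 0)) (s≤s z≤n)) ⟩
        + 1 * + 1 * Q 0 - + 1 * + 0 * Q 0
          ≡⟨ cong (λ q → + 1 * + 1 * q - + 1 * + 0 * q) (choose-0≡1 h (suc a) (idxQ (+ h) (+ a)) a<h) ⟩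
        + 1 ∎
        where open ≡-Reasoning
      collapse (suc d) = trans
        (cong (λ u → + 1 * + 1 * Q (suc d) - + 1 * u * Q (suc d)) (choose-0≡1 d 0 (idxL′ (+ a) (+ d)) z≤n))
        (ℤP.+-inverseʳ (+ 1 * + 1 * Q (suc d)))
        where
        idxL′ : ∀ a d → + 1 + (a + (+ 1 + d)) - (+ 1 + a) - + 1 ≡ d - + 0
        idxL′ = solve-∀

  h≤N′ : h ℕ.≤ N′
  h≤N′ = m+m≤1+n⇒m≤n 2h≤N

  evenA-top : ∀ a D → evenA (suc a) N′ D ≡ + 0
  evenA-top a D with D ℕ.<? N
  ... | yes D<N = evenA-zeroˡ (suc a) N′ D (choose-vanishes D 1 refl (subst (D ℕ.<_) (ℕP.+-comm 1 N′) D<N))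
  ... | no  D≮N = evenA-zeroʳ (suc a) N′ D
                    (choose-vanishes (h ℕ.+ N) (suc a ℕ.+ D) (idx (+ h) (+ a) (+ D) (+ N′)) (begin-strict
                      h ℕ.+ N              <⟨ ℕP.+-monoˡ-< N (ℕP.<-≤-trans (s≤s h≤N′) (ℕP.≮⇒≥ D≮N)) ⟩
                      D ℕ.+ N              ≡⟨ ℕP.+-comm D N ⟩
                      N ℕ.+ D              ≤⟨ ℕP.+-monoʳ-≤ N (ℕP.m≤n+m D (suc a)) ⟩
                      N ℕ.+ (suc a ℕ.+ D)  ∎))
    where
    open ℕP.≤-Reasoning
    idx : ∀ h a D n → h - (+ 1 + a) - D + n + + 1 ≡ h + (+ 1 + n) - (+ 1 + a + D)
    idx = solve-∀

  oddA-top : ∀ a r → oddA (suc a) N r ≡ + 0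
  oddA-top a r = oddA-zeroʳ (suc a) N r (choose-vanishes N (r ℕ.+ suc a) (idx (+ N) (+ r) (+ a))
                   (ℕP.m<m+n N (ℕP.≤-trans (s≤s z≤n) (ℕP.m≤n+m (suc a) r))))
    where
    idx : ∀ n r a → n - r - (+ 1 + a) ≡ n - (r + (+ 1 + a))
    idx = solve-∀

  evenA-large : ∀ c m D → N ℕ.≤ c ℕ.+ c → evenA c m D ≡ + 0
  evenA-large c m zero    _     = evenA-zeroˡ c m 0 (choose-vanishes 0 1 refl (ℕP.m≤n+m 1 m))
  evenA-large c m (suc D) N≤2c = evenA-zeroʳ c m (suc D)
    (choose-vanishes (h ℕ.+ m) (c ℕ.+ D) (idx (+ h) (+ c) (+ D) (+ m))
      (s≤s (subst (ℕ._≤ m ℕ.+ (c ℕ.+ D)) (ℕP.+-comm m h) (ℕP.+-monoʳ-≤ m (ℕP.≤-trans h≤c (ℕP.m≤m+n c D))))))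
    where
    h≤c : h ℕ.≤ c
    h≤c = m+m≤1+n+n⇒m≤n (ℕP.≤-trans 2h≤N (ℕP.≤-trans N≤2c (ℕP.n≤1+n _)))
    idx : ∀ h c D m → h - c - (+ 1 + D) + m + + 1 ≡ h + m - (c + D)
    idx = solve-∀

  oddA-large : ∀ c m r → N ℕ.≤ c ℕ.+ c → oddA c m r ≡ + 0
  oddA-large c m r N≤2c with r ℕ.≤? h
  ... | yes r≤h = oddA-zeroˡ c m r (choose-vanishes (m ℕ.+ r) (suc h) (idx (+ m) (+ r) (+ h)) (ℕP.+-monoʳ-< m (s≤s r≤h)))
    where
    idx : ∀ m r h → m + r - h - + 1 ≡ m + r - (+ 1 + h)
    idx = solve-∀
  ... | no  r≰h = oddA-zeroʳ c m r (choose-vanishes N (r ℕ.+ c) (idx (+ N) (+ r) (+ c)) (begin-strict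
        N                  ≤⟨ N≤h+c ⟩
        h ℕ.+ c            <⟨ ℕP.+-monoˡ-< c (ℕP.≰⇒> r≰h) ⟩
        r ℕ.+ c            ≤⟨ ℕP.m≤n+m (r ℕ.+ c) m ⟩
        m ℕ.+ (r ℕ.+ c)    ∎))
    where
    open ℕP.≤-Reasoning
    idx : ∀ n r c → n - r - c ≡ n - (r + c)
    idx = solve-∀
    N≤h+c : N ℕ.≤ h ℕ.+ c
    N≤h+c with c ℕ.≤? h
    ... | yes c≤h = ℕP.≤-trans N≤2c (ℕP.+-monoˡ-≤ c c≤h)
    ... | no  c≰h = ℕP.≤-trans N≤2h+1 (subst (ℕ._≤ h ℕ.+ c) (ℕP.+-suc h h) (ℕP.+-monoʳ-≤ h (ℕP.≰⇒> c≰h)))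

  evenB-large : ∀ a m E → N ℕ.≤ suc (a ℕ.+ a) → evenB a m E ≡ + 0
  evenB-large a m E N≤2a+1 with E ℕ.≤? a
  ... | yes E≤a = evenB-below a m E≤a
  ... | no  E≰a = evenB-zeroʳ a m E (choose-vanishes (h ℕ.+ m) E (idx (+ h) (+ E) (+ m))
        (subst (ℕ._< m ℕ.+ E) (ℕP.+-comm m h) (ℕP.+-monoʳ-< m (ℕP.≤-<-trans h≤a (ℕP.≰⇒> E≰a)))))
    where
    h≤a : h ℕ.≤ a
    h≤a = m+m≤1+n+n⇒m≤n (ℕP.≤-trans 2h≤N N≤2a+1)
    idx : ∀ h E m → h - E + m ≡ h + m - E
    idx = solve-∀

  oddB-large : ∀ a m r → N ℕ.≤ suc (a ℕ.+ a) → oddB a m r ≡ + 0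
  oddB-large a m r N≤2a+1 with r ℕ.≤? h ℕ.+ 1 ℕ.+ a
  ... | yes r≤h+1+a = oddB-below a m r≤h+1+a
  ... | no  r≰h+1+a = oddB-zeroʳ a m r (choose-vanishes N r refl (begin-strict
        N                  ≤⟨ N≤2h+1 ⟩
        suc (h ℕ.+ h)      ≤⟨ s≤s (ℕP.+-monoʳ-≤ h (m+m≤1+n+n⇒m≤n (ℕP.≤-trans 2h≤N N≤2a+1))) ⟩
        suc (h ℕ.+ a)      ≡⟨ trans (ℕP.+-assoc h 1 a) (ℕP.+-suc h a) ⟨
        h ℕ.+ 1 ℕ.+ a      <⟨ ℕP.≰⇒> r≰h+1+a ⟩
        r                  ≤⟨ ℕP.m≤n+m r m ⟩
        m ℕ.+ r            ∎))
    where open ℕP.≤-Reasoning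

  closedA-≥ : ∀ c s → N ℕ.≤ c ℕ.+ c → closedA c s ≡ δ s
  closedA-≥ c s N≤2c = trans
    (cong₂ (λ u v → δ s + (u + v))
      (sumTo-zeros N (λ m → shift-zeros (suc m ℕ.* N) (λ D → evenA-large c m D N≤2c) s))
      (sumTo-zeros (suc N) (λ m → shift-zeros (m ℕ.* suc N) (λ r → oddA-large c m r N≤2c) s)))
    (ℤP.+-identityʳ (δ s))

  closedB-≥ : ∀ a s → N ℕ.≤ suc (a ℕ.+ a) → closedB a s ≡ δ s
  closedB-≥ a s N≤2a+1 = trans
    (cong₂ (λ u v → δ s + (u + v))
      (sumTo-zeros N (λ m → shift-zeros (m ℕ.* N) (λ E → evenB-large a m E N≤2a+1) s))
      (sumTo-zeros N (λ m → shift-zeros (m ℕ.* suc N) (λ r → oddB-large a m r N≤2a+1) s)))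
    (ℤP.+-identityʳ (δ s))

  closedA-rec : ∀ c s → suc (c ℕ.+ c) ℕ.≤ N → closedA c s ≡ closedA (suc c) s - shift (N ∸ c) (closedB c) s
  closedA-rec c s 2c<N = begin
    δ s + (sumTo N (λ m → shift (suc m ℕ.* N) (evenA c m) s)
           + (oddA c 0 s + sumTo N (λ m → shift (suc m ℕ.* suc N) (oddA c (suc m)) s)))
      ≡⟨ cong₂ (λ u v → δ s + (u + v))
               (trans (sumTo-cong N evenStep) (sumTo-- N E′ X))
               (cong₂ _+_ zeroStep (trans (sumTo-cong N oddStep) (sumTo-- N O′ Y))) ⟩
    δ s + ((sumTo N E′ - sumTo N X) + ((oddA (suc c) 0 s - shift K δ s) + (sumTo N O′ - sumTo N Y)))
      ≡⟨ regroup (δ s) (sumTo N E′) (sumTo N X) (oddA (suc c) 0 s) (shift K δ s) (sumTo N O′) (sumTo N Y) ⟩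
    closedA (suc c) s - (shift K δ s + (sumTo N X + sumTo N Y))
      ≡⟨ cong (_-_ (closedA (suc c) s))
              (shift-δ+sums K N N (λ m → shift (m ℕ.* N) (evenB c m)) (λ m → shift (m ℕ.* suc N) (oddB c m)) s) ⟨
    closedA (suc c) s - shift K (closedB c) s ∎
    where
    open ≡-Reasoning
    K = N ∸ c
    K+c≡N : K ℕ.+ c ≡ N
    K+c≡N = ℕP.m∸n+n≡m (ℕP.≤-trans (ℕP.m≤m+n c c) (ℕP.<⇒≤ 2c<N))
    E′ X O′ Y : ℕ → ℤ
    E′ m = shift (suc m ℕ.* N) (evenA (suc c) m) s
    X  m = shift K (shift (m ℕ.* N) (evenB c m)) s
    O′ m = shift (suc m ℕ.* suc N) (oddA (suc c) (suc m)) s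
    Y  m = shift K (shift (m ℕ.* suc N) (oddB c m)) s
    peel : ∀ k x c′ {F G H : ℕ → ℤ} → K ℕ.+ x ℕ.+ c′ ≡ k → shift c′ (λ D → F D - G D) ≗ (λ E → - H E) →
           shift k F s ≡ shift k G s - shift K (shift x H) s
    peel k x c′ {F} {G} {H} k≡ diff = trans (shift-split k F G s) (cong (_+_ (shift k G s)) (begin
      shift k (λ D → F D - G D) s                 ≡⟨ cong (λ k → shift k (λ D → F D - G D) s) k≡ ⟨
      shift (K ℕ.+ x ℕ.+ c′) (λ D → F D - G D) s  ≡⟨ shift-shift-≗ K x c′ diff s ⟩
      shift K (shift x (λ E → - H E)) s           ≡⟨ shift-cong K (shift-neg x H) s ⟩
      shift K (λ y → - shift x H y) s             ≡⟨ shift-neg K (shift x H) s ⟩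
      - shift K (shift x H) s                     ∎))
    shuffle : ∀ k x c → k ℕ.+ x ℕ.+ c ≡ (k ℕ.+ c) ℕ.+ x
    shuffle = ℕSolver.solve-∀
    evenStep : ∀ m → shift (suc m ℕ.* N) (evenA c m) s ≡ E′ m - X m
    evenStep m = peel (suc m ℕ.* N) (m ℕ.* N) c
      (trans (shuffle K (m ℕ.* N) c) (cong (ℕ._+ m ℕ.* N) K+c≡N)) (evenA-diff c m)
    oddStep : ∀ m → shift (suc m ℕ.* suc N) (oddA c (suc m)) s ≡ O′ m - Y m
    oddStep m = peel (suc m ℕ.* suc N) (m ℕ.* suc N) (suc c)
      (trans (shuffle K (m ℕ.* suc N) (suc c)) (cong (ℕ._+ m ℕ.* suc N) (trans (ℕP.+-suc K c) (cong suc K+c≡N))))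
      (oddA-diff c m)
    zeroStep : oddA c 0 s ≡ oddA (suc c) 0 s - shift K δ s
    zeroStep = trans (sym (undo (oddA (suc c) 0 s) (oddA c 0 s)))
                     (cong (_-_ (oddA (suc c) 0 s)) (sym (oddA-zero-diff c 2c<N s)))
      where
      undo : ∀ b a → b - (b - a) ≡ a
      undo = solve-∀
    regroup : ∀ d e x o k p y → d + ((e - x) + ((o - k) + (p - y))) ≡ (d + (e + (o + p))) - (k + (x + y))
    regroup = solve-∀

  closedB-rec : ∀ a s → suc (suc (a ℕ.+ a)) ℕ.≤ N → closedB a s ≡ closedB (suc a) s + shift (suc a) (closedA (suc a)) s
  closedB-rec a s 2a+1<N = begin
    δ s + ((evenB a 0 s + sumTo N′ (λ m → shift (suc m ℕ.* N) (evenB a (suc m)) s))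
           + sumTo N (λ m → shift (m ℕ.* suc N) (oddB a m) s))
      ≡⟨ cong₂ (λ u v → δ s + (u + v))
               (cong₂ _+_ zeroStep (trans (sumTo-cong N′ evenStep) (sumTo-+ N′ E′ P)))
               (trans (sumTo-cong N oddStep) (sumTo-+ N O′ Q)) ⟩
    δ s + (((evenB (suc a) 0 s + shift (suc a) δ s) + (sumTo N′ E′ + sumTo N′ P)) + (sumTo N O′ + sumTo N Q))
      ≡⟨ regroup (δ s) (evenB (suc a) 0 s) (shift (suc a) δ s) (sumTo N′ E′) (sumTo N′ P) (sumTo N O′) (sumTo N Q) ⟩
    closedB (suc a) s + (shift (suc a) δ s + (sumTo N′ P + sumTo N Q))
      ≡⟨ cong (_+_ (closedB (suc a) s)) shiftedA ⟨
    closedB (suc a) s + shift (suc a) (closedA (suc a)) s ∎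
    where
    open ≡-Reasoning
    E′ P O′ Q : ℕ → ℤ
    E′ m = shift (suc m ℕ.* N) (evenB (suc a) (suc m)) s
    P  m = shift (suc a) (shift (suc m ℕ.* N) (evenA (suc a) m)) s
    O′ m = shift (m ℕ.* suc N) (oddB (suc a) m) s
    Q  m = shift (suc a) (shift (m ℕ.* suc N) (oddA (suc a) m)) s
    peel : ∀ k {F G H : ℕ → ℤ} → shift (suc a) H ≗ (λ x → F x - G x) →
           shift k F s ≡ shift k G s + shift (suc a) (shift k H) s
    peel k {F} {G} {H} diff = trans (shift-split k F G s) (cong (_+_ (shift k G s))
      (trans (shift-cong k (λ x → sym (diff x)) s) (shift-comm k (suc a) H s)))
    evenStep : ∀ m → shift (suc m ℕ.* N) (evenB a (suc m)) s ≡ E′ m + P m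
    evenStep m = peel (suc m ℕ.* N) (evenB-diff a m)
    oddStep : ∀ m → shift (m ℕ.* suc N) (oddB a m) s ≡ O′ m + Q m
    oddStep m = peel (m ℕ.* suc N) (oddB-diff a m)
    a<h : suc a ℕ.≤ h
    a<h = m+m≤1+n+n⇒m≤n (ℕP.≤-trans (subst (ℕ._≤ N) (sym (cong suc (ℕP.+-suc a a))) 2a+1<N) N≤2h+1)
    zeroStep : evenB a 0 s ≡ evenB (suc a) 0 s + shift (suc a) δ s
    zeroStep = trans (addBack (evenB a 0 s) (evenB (suc a) 0 s))
                     (cong (_+_ (evenB (suc a) 0 s)) (sym (evenB-zero-diff a a<h s)))
      where
      addBack : ∀ x y → x ≡ y + (x - y)
      addBack = solve-∀
    regroup : ∀ d e k x p o q → d + (((e + k) + (x + p)) + (o + q)) ≡ (d + ((e + x) + o)) + (k + (p + q))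
    regroup = solve-∀
    shiftedA : shift (suc a) (closedA (suc a)) s ≡ shift (suc a) δ s + (sumTo N′ P + sumTo N Q)
    shiftedA = begin
      shift (suc a) (closedA (suc a)) s
        ≡⟨ shift-δ+sums (suc a) N (suc N) (λ m → shift (suc m ℕ.* N) (evenA (suc a) m))
                                           (λ m → shift (m ℕ.* suc N) (oddA (suc a) m)) s ⟩
      shift (suc a) δ s + (sumTo (suc N′) P + sumTo (suc N) Q)
        ≡⟨ cong₂ (λ u v → shift (suc a) δ s + (u + v)) (sumTo-snoc N′ P) (sumTo-snoc N Q) ⟩
      shift (suc a) δ s + ((sumTo N′ P + P N′) + (sumTo N Q + Q N))
        ≡⟨ cong₂ (λ u v → shift (suc a) δ s + ((sumTo N′ P + u) + (sumTo N Q + v)))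
                 (shift-zeros (suc a) (shift-zeros (N ℕ.* N) (evenA-top a)) s)
                 (shift-zeros (suc a) (shift-zeros (N ℕ.* suc N) (oddA-top a)) s) ⟩
      shift (suc a) δ s + ((sumTo N′ P + + 0) + (sumTo N Q + + 0))
        ≡⟨ cong₂ (λ u v → shift (suc a) δ s + (u + v)) (ℤP.+-identityʳ (sumTo N′ P)) (ℤP.+-identityʳ (sumTo N Q)) ⟩
      shift (suc a) δ s + (sumTo N′ P + sumTo N Q) ∎

module Coefficient (N′ : ℕ) where

  open import Data.Integer using (_+_; _-_; _*_; -_)

  N : ℕ
  N = suc N′

  h : ℕ
  h = N / 2

  2h≤N : h ℕ.+ h ℕ.≤ N
  2h≤N = subst (ℕ._≤ N) (double h) (m/n*n≤m N 2)
    where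
    double : ∀ x → x ℕ.* 2 ≡ x ℕ.+ x
    double = ℕSolver.solve-∀

  N≤2h+1 : N ℕ.≤ suc (h ℕ.+ h)
  N≤2h+1 = begin
    N                   ≡⟨ m≡m%n+[m/n]*n N 2 ⟩
    N % 2 ℕ.+ h ℕ.* 2    ≤⟨ ℕP.+-monoˡ-≤ (h ℕ.* 2) (ℕP.≤-pred (m%n<n N 2)) ⟩
    1 ℕ.+ h ℕ.* 2        ≡⟨ cong suc (double h) ⟩
    suc (h ℕ.+ h)        ∎
    where
    open ℕP.≤-Reasoning
    double : ∀ x → x ℕ.* 2 ≡ x ℕ.+ x
    double = ℕSolver.solve-∀

  open CompositionSeries N
  open ClosedForm N′ h 2h≤N N≤2h+1 hiding (N)

  A≗closedA×B≗closedB : ∀ k c → N ∸ (c ℕ.+ c) ℕ.≤ k → (A c ≗ closedA c) × (B c ≗ closedB c)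
  A≗closedA×B≗closedB zero    c bound = A≗ , B≗
    where
    N≤2c = ℕP.m∸n≡0⇒m≤n (ℕP.n≤0⇒n≡0 bound)
    A≗ : A c ≗ closedA c
    A≗ s = trans (A-≥ c s N≤2c) (sym (closedA-≥ c s N≤2c))
    B≗ : B c ≗ closedB c
    B≗ s = trans (B-≥ c s (ℕP.m≤n⇒m≤1+n N≤2c)) (sym (closedB-≥ c s (ℕP.m≤n⇒m≤1+n N≤2c)))
  A≗closedA×B≗closedB (suc k) c bound = A≗ , B≗
    where
    open ≡-Reasoning
    IH = A≗closedA×B≗closedB k (suc c) (∸[m+m]-step N c bound)
    B≗ : B c ≗ closedB c
    B≗ s with N ℕ.≤? suc (c ℕ.+ c)
    ... | yes N≤2c+1 = trans (B-≥ c s N≤2c+1) (sym (closedB-≥ c s N≤2c+1))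
    ... | no  N≰2c+1 = begin
      B c s                                                 ≡⟨ B-rec c s (ℕP.≰⇒> N≰2c+1) ⟩
      B (suc c) s + shift (suc c) (A (suc c)) s             ≡⟨ cong₂ _+_ (proj₂ IH s) (shift-cong (suc c) (proj₁ IH) s) ⟩
      closedB (suc c) s + shift (suc c) (closedA (suc c)) s ≡⟨ closedB-rec c s (ℕP.≰⇒> N≰2c+1) ⟨
      closedB c s                                           ∎
    A≗ : A c ≗ closedA c
    A≗ s with N ℕ.≤? c ℕ.+ c
    ... | yes N≤2c = trans (A-≥ c s N≤2c) (sym (closedA-≥ c s N≤2c))
    ... | no  N≰2c = begin
      A c s                                           ≡⟨ A-rec c s (ℕP.≰⇒> N≰2c) ⟩
      A (suc c) s - shift (N ∸ c) (B c) s             ≡⟨ cong₂ _-_ (proj₁ IH s) (shift-cong (N ∸ c) B≗ s) ⟩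
      closedA (suc c) s - shift (N ∸ c) (closedB c) s ≡⟨ closedA-rec c s (ℕP.≰⇒> N≰2c) ⟨
      closedA c s                                     ∎

  evenCoeff : ℕ → ℕ → ℤ
  evenCoeff zero    r = + 0
  evenCoeff (suc q) r = evenA 0 q r

  evenA0-vanishes : ∀ m {D} → h ℕ.< D → evenA 0 m D ≡ + 0
  evenA0-vanishes m {D} h<D = evenA-zeroʳ 0 m D (choose-vanishes (h ℕ.+ suc m) D (idx (+ h) (+ D) (+ m))
    (subst (ℕ._< suc m ℕ.+ D) (ℕP.+-comm (suc m) h) (ℕP.+-monoʳ-< (suc m) h<D)))
    where
    idx : ∀ h D m → h - + 0 - D + m + + 1 ≡ h + (+ 1 + m) - D
    idx = solve-∀

  oddA0-vanishes : ∀ m {r} → N ℕ.< m ℕ.+ r → oddA 0 m r ≡ + 0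
  oddA0-vanishes m {r} N<m+r = oddA-zeroʳ 0 m r (choose-vanishes N r (idx (+ N) (+ r)) N<m+r)
    where
    idx : ∀ n r → n - r - + 0 ≡ n - r
    idx = solve-∀

  coeffφ-closed : ∀ s → coeffφ N s ≡ δ s + (evenCoeff (s / N) (s % N) + oddA 0 (s / suc N) (s % suc N))
  coeffφ-closed s = begin
    coeffφ N s   ≡⟨ coeffφ≡A0 s ⟩
    A 0 s        ≡⟨ proj₁ (A≗closedA×B≗closedB N 0 ℕP.≤-refl) s ⟩
    closedA 0 s  ≡⟨ cong₂ (λ u v → δ s + (u + v))
                          (trans (cong (λ x → sumTo N (λ m → shift (suc m ℕ.* N) (evenA 0 m) x)) (m≡m%n+[m/n]*n s N))
                                 (evenSum (s / N) (m%n<n s N)))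
                          (trans (cong (λ x → sumTo (suc N) (λ m → shift (m ℕ.* suc N) (oddA 0 m) x)) (m≡m%n+[m/n]*n s (suc N)))
                                 (oddSum (s / suc N) (m%n<n s (suc N)))) ⟩
    δ s + (evenCoeff (s / N) (s % N) + oddA 0 (s / suc N) (s % suc N)) ∎
    where
    open ≡-Reasoning
    evenA0-beyond : ∀ m D → N ℕ.≤ D → evenA 0 m D ≡ + 0
    evenA0-beyond m D N≤D = evenA0-vanishes m (ℕP.<-≤-trans (s≤s h≤N′) N≤D)
    oddA0-beyond : ∀ m r → suc N ℕ.≤ r → oddA 0 m r ≡ + 0
    oddA0-beyond m r N<r = oddA0-vanishes m (ℕP.≤-trans N<r (ℕP.m≤n+m r m))
    evenSum : ∀ q {r} → r ℕ.< N → sumTo N (λ m → shift (suc m ℕ.* N) (evenA 0 m) (r ℕ.+ q ℕ.* N)) ≡ evenCoeff q r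
    evenSum q {r} r<N = trans (sumTo-cong N (λ m → shift-multiple N (suc m) (evenA 0 m) q r<N (evenA0-beyond m))) (select q)
      where
      select : ∀ q → sumTo N (λ m → if suc m ≡ᵇ q then evenA 0 m r else + 0) ≡ evenCoeff q r
      select zero    = sumTo-zeros N (λ _ → refl)
      select (suc q) = sumTo-select N q (λ m → evenA 0 m r)
        (λ N≤q → evenA-zeroˡ 0 q r (choose-vanishes r 1 refl (subst (r ℕ.<_) (ℕP.+-comm 1 q) (ℕP.≤-trans r<N (ℕP.m≤n⇒m≤1+n N≤q)))))
    oddSum : ∀ q {r} → r ℕ.< suc N → sumTo (suc N) (λ m → shift (m ℕ.* suc N) (oddA 0 m) (r ℕ.+ q ℕ.* suc N)) ≡ oddA 0 q r
    oddSum q {r} r<N+1 = trans (sumTo-cong (suc N) (λ m → shift-multiple (suc N) m (oddA 0 m) q r<N+1 (oddA0-beyond m)))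
      (sumTo-select (suc N) q (λ m → oddA 0 m r)
        (λ N<q → oddA0-vanishes q (ℕP.≤-trans N<q (ℕP.m≤m+n q r))))

  evenCoeff-outside : ∀ q r → ¬ (q ℕ.≤ r × r ℕ.≤ h) → evenCoeff q r ≡ + 0
  evenCoeff-outside zero    r _ = refl
  evenCoeff-outside (suc q) r outside with suc q ℕ.≤? r | r ℕ.≤? h
  ... | yes q<r | yes r≤h = ⊥-elim (outside (q<r , r≤h))
  ... | yes _   | no  r≰h = evenA0-vanishes q (ℕP.≰⇒> r≰h)
  ... | no  q≮r | _       = evenA-zeroˡ 0 q r
                              (choose-vanishes r 1 refl (subst (r ℕ.<_) (ℕP.+-comm 1 q) (ℕP.≰⇒> q≮r)))

  oddA0-outside : ∀ q r → ¬ (h ℕ.< r × q ℕ.+ r ℕ.≤ N) → oddA 0 q r ≡ + 0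
  oddA0-outside q r outside with h ℕ.<? r | q ℕ.+ r ℕ.≤? N
  ... | yes h<r | yes q+r≤N = ⊥-elim (outside (h<r , q+r≤N))
  ... | yes _   | no  q+r≰N = oddA0-vanishes q (ℕP.≰⇒> q+r≰N)
  ... | no  h≮r | _         = oddA-zeroˡ 0 q r
                                (choose-vanishes (q ℕ.+ r) (suc h) (idx (+ q) (+ r) (+ h)) (ℕP.+-monoʳ-< q (s≤s (ℕP.≮⇒≥ h≮r))))
    where
    idx : ∀ q r h → q + r - h - + 1 ≡ q + r - (+ 1 + h)
    idx = solve-∀

  oddTerm : ℕ → ℕ → ℤ
  oddTerm q r = sgn (q ℕ.+ 1) * binomℤ (+ N - + r) (+ q) * binomℤ (+ q + + r - + h - + 1) (+ q)

  evenTerm : ℕ → ℕ → ℤ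
  evenTerm q r = sgn q * binomℤ (+ r - + 1) (+ q - + 1) * binomℤ (+ h - + r + + q) (+ q)

  oddTerm≡oddA0 : ∀ q {r} → h ℕ.< r → r ℕ.≤ N → oddTerm q r ≡ oddA 0 q r
  oddTerm≡oddA0 q {r} h<r r≤N = begin
    sgn (q ℕ.+ 1) * binomℤ (+ N - + r) (+ q) * binomℤ (+ q + + r - + h - + 1) (+ q)
      ≡⟨ cong₂ (λ ε u → ε * binomℤ (+ N - + r) (+ q) * u) (cong sgn (ℕP.+-comm q 1)) lower ⟩
    sgn (suc q) * binomℤ (+ N - + r) (+ q) * choose (+ q + + r - + h - + 1) q
      ≡⟨ cong (λ u → sgn (suc q) * u * choose (+ q + + r - + h - + 1) q) (binomℤ≡choose q r≤N) ⟩
    sgn (suc q) * choose (+ N - + r) q * choose (+ q + + r - + h - + 1) q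
      ≡⟨ swap (sgn (suc q)) _ _ ⟩
    sgn (suc q) * choose (+ q + + r - + h - + 1) q * choose (+ N - + r) q
      ≡⟨ cong (λ x → sgn (suc q) * choose (+ q + + r - + h - + 1) q * choose x q) (idx₀ (+ N - + r)) ⟩
    oddA 0 q r ∎
    where
    open ≡-Reasoning
    idx : ∀ q r h → q + r - h - + 1 ≡ q + r - (+ 1 + h)
    idx = solve-∀
    idx₀ : ∀ x → x ≡ x - + 0
    idx₀ = solve-∀
    swap : ∀ ε a b → ε * a * b ≡ ε * b * a
    swap = solve-∀
    lower : binomℤ (+ q + + r - + h - + 1) (+ q) ≡ choose (+ q + + r - + h - + 1) q
    lower = begin
      binomℤ (+ q + + r - + h - + 1) (+ q)   ≡⟨ cong (λ x → binomℤ x (+ q)) (idx (+ q) (+ r) (+ h)) ⟩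
      binomℤ (+ q + + r - (+ 1 + + h)) (+ q) ≡⟨ binomℤ≡choose q (ℕP.≤-trans h<r (ℕP.m≤n+m r q)) ⟩
      choose (+ q + + r - (+ 1 + + h)) q     ≡⟨ cong (λ x → choose x q) (idx (+ q) (+ r) (+ h)) ⟨
      choose (+ q + + r - + h - + 1) q       ∎

  evenTerm-zero : ∀ r → evenTerm 0 r ≡ + 0
  evenTerm-zero r = ℤP.*-zeroˡ (binomℤ (+ h - + r + + 0) (+ 0))

  evenTerm≡evenCoeff : ∀ q r → suc r ℕ.≤ h → evenTerm (suc q) (suc r) ≡ evenCoeff (suc q) (suc r)
  evenTerm≡evenCoeff q r r<h = cong (λ u → sgn (suc q) * + (r C q) * u) (begin
    binomℤ (+ h - + suc r + + suc q) (+ suc q)      ≡⟨ cong (λ x → binomℤ x (+ suc q)) (idx (+ h) (+ r) (+ q)) ⟩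
    binomℤ (+ h + + suc q - + suc r) (+ suc q)      ≡⟨ binomℤ≡choose (suc q) (ℕP.≤-trans r<h (ℕP.m≤m+n h (suc q))) ⟩
    choose (+ h + + suc q - + suc r) (suc q)        ≡⟨ cong (λ x → choose x (suc q)) (idx′ (+ h) (+ r) (+ q)) ⟩
    choose (+ h - + 0 - + suc r + + q + + 1) (suc q) ∎)
    where
    open ≡-Reasoning
    idx : ∀ h r q → h - (+ 1 + r) + (+ 1 + q) ≡ h + (+ 1 + q) - (+ 1 + r)
    idx = solve-∀
    idx′ : ∀ h r q → h + (+ 1 + q) - (+ 1 + r) ≡ h - + 0 - (+ 1 + r) + q + + 1
    idx′ = solve-∀

  module Degree (s : ℕ) where

    q₀ r₀ q₁ r₁ t : ℕ
    q₀ = s / N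
    r₀ = s % N
    q₁ = s / suc N
    r₁ = s % suc N
    t  = (2 ℕ.* s) / suc N

    s≡r₀+q₀N : s ≡ r₀ ℕ.+ q₀ ℕ.* N
    s≡r₀+q₀N = m≡m%n+[m/n]*n s N

    s≡r₁+q₁[N+1] : s ≡ r₁ ℕ.+ q₁ ℕ.* suc N
    s≡r₁+q₁[N+1] = m≡m%n+[m/n]*n s (suc N)

    r₁≤N : r₁ ℕ.≤ N
    r₁≤N = ℕP.≤-pred (m%n<n s (suc N))

    t≡ : ∀ R K → 2 ℕ.* s ≡ R ℕ.+ K ℕ.* suc N → R ℕ.< suc N → t ≡ K
    t≡ R K 2s≡ R<N+1 = trans (cong (_/ suc N) 2s≡) ([r+kn]/n≡k K R<N+1)

    even-parity : q₀ ℕ.≤ r₀ → r₀ ℕ.≤ h → T (isEven t)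
    even-parity q₀≤r₀ r₀≤h =
      subst (T ∘ isEven) (sym (t≡ (e ℕ.+ e) (q₀ ℕ.+ q₀) 2s≡ e+e<N+1)) (subst (T ∘ not) (sym (isOdd-double q₀)) _)
      where
      e = r₀ ∸ q₀
      rearrange : ∀ q e n → 2 ℕ.* ((q ℕ.+ e) ℕ.+ q ℕ.* n) ≡ (e ℕ.+ e) ℕ.+ (q ℕ.+ q) ℕ.* suc n
      rearrange = ℕSolver.solve-∀
      2s≡ : 2 ℕ.* s ≡ (e ℕ.+ e) ℕ.+ (q₀ ℕ.+ q₀) ℕ.* suc N
      2s≡ = begin
        2 ℕ.* s                           ≡⟨ cong (2 ℕ.*_) s≡r₀+q₀N ⟩
        2 ℕ.* (r₀ ℕ.+ q₀ ℕ.* N)           ≡⟨ cong (λ x → 2 ℕ.* (x ℕ.+ q₀ ℕ.* N)) (ℕP.m+[n∸m]≡n q₀≤r₀) ⟨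
        2 ℕ.* ((q₀ ℕ.+ e) ℕ.+ q₀ ℕ.* N)   ≡⟨ rearrange q₀ e N ⟩
        (e ℕ.+ e) ℕ.+ (q₀ ℕ.+ q₀) ℕ.* suc N ∎
        where open ≡-Reasoning
      e≤h : e ℕ.≤ h
      e≤h = ℕP.≤-trans (ℕP.m∸n≤m r₀ q₀) r₀≤h
      e+e<N+1 : e ℕ.+ e ℕ.< suc N
      e+e<N+1 = s≤s (ℕP.≤-trans (ℕP.+-mono-≤ e≤h e≤h) 2h≤N)

    odd-parity : h ℕ.< r₁ → T (isOdd t)
    odd-parity h<r₁ =
      subst (T ∘ isOdd) (sym (t≡ R (suc (q₁ ℕ.+ q₁)) 2s≡ R<N+1)) (subst T (sym (isOdd-suc-double q₁)) _)
      where
      N+1≤2r₁ : suc N ℕ.≤ r₁ ℕ.+ r₁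
      N+1≤2r₁ = ℕP.≤-trans (s≤s N≤2h+1) (subst (ℕ._≤ r₁ ℕ.+ r₁) (cong suc (ℕP.+-suc h h)) (ℕP.+-mono-≤ h<r₁ h<r₁))
      R = r₁ ℕ.+ r₁ ∸ suc N
      R+N+1≡2r₁ : R ℕ.+ suc N ≡ r₁ ℕ.+ r₁
      R+N+1≡2r₁ = ℕP.m∸n+n≡m N+1≤2r₁
      R<N+1 : R ℕ.< suc N
      R<N+1 = ℕP.+-cancelʳ-< (suc N) R (suc N)
                (subst (ℕ._< suc N ℕ.+ suc N) (sym R+N+1≡2r₁) (ℕP.+-mono-≤-< (ℕP.m≤n⇒m≤1+n r₁≤N) (s≤s r₁≤N)))
      double : ∀ r q m → 2 ℕ.* (r ℕ.+ q ℕ.* m) ≡ (r ℕ.+ r) ℕ.+ (q ℕ.+ q) ℕ.* m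
      double = ℕSolver.solve-∀
      absorb : ∀ R q m → (R ℕ.+ m) ℕ.+ (q ℕ.+ q) ℕ.* m ≡ R ℕ.+ suc (q ℕ.+ q) ℕ.* m
      absorb = ℕSolver.solve-∀
      2s≡ : 2 ℕ.* s ≡ R ℕ.+ suc (q₁ ℕ.+ q₁) ℕ.* suc N
      2s≡ = begin
        2 ℕ.* s                                     ≡⟨ cong (2 ℕ.*_) s≡r₁+q₁[N+1] ⟩
        2 ℕ.* (r₁ ℕ.+ q₁ ℕ.* suc N)                 ≡⟨ double r₁ q₁ (suc N) ⟩
        (r₁ ℕ.+ r₁) ℕ.+ (q₁ ℕ.+ q₁) ℕ.* suc N       ≡⟨ cong (ℕ._+ (q₁ ℕ.+ q₁) ℕ.* suc N) R+N+1≡2r₁ ⟨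
        (R ℕ.+ suc N) ℕ.+ (q₁ ℕ.+ q₁) ℕ.* suc N     ≡⟨ absorb R q₁ (suc N) ⟩
        R ℕ.+ suc (q₁ ℕ.+ q₁) ℕ.* suc N             ∎
        where open ≡-Reasoning

    -- On the even branch r₀ = 0 is excluded by parity: then s = q₀ N, and 2s = (2q₀ − 1)(N + 1) + (N + 1 − 2q₀).
    r₀≡0-parity : ∀ {q} → r₀ ≡ 0 → q₀ ≡ suc q → 2 ℕ.* s ℕ.≤ N ℕ.* suc N → T (isOdd t)
    r₀≡0-parity {q} r₀≡0 q₀≡ bounded =
      subst (T ∘ isOdd) (sym (t≡ R K 2s≡ (s≤s (ℕP.m∸n≤m N K)))) (subst T (sym (isOdd-suc-double q)) _)
      where
      K = suc (q ℕ.+ q)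
      s≡ : s ≡ suc q ℕ.* N
      s≡ = trans s≡r₀+q₀N (cong₂ (λ r q → r ℕ.+ q ℕ.* N) r₀≡0 q₀≡)
      double : ∀ q n → 2 ℕ.* (suc q ℕ.* n) ≡ (suc q ℕ.+ suc q) ℕ.* n
      double = ℕSolver.solve-∀
      K≤N : K ℕ.≤ N
      K≤N = subst (ℕ._≤ N) (ℕP.+-suc q q) (ℕP.≤-pred (ℕP.*-cancelʳ-≤ (suc q ℕ.+ suc q) (suc N) N
              (subst₂ ℕ._≤_ (trans (cong (2 ℕ.*_) s≡) (double q N)) (ℕP.*-comm N (suc N)) bounded)))
      R = N ∸ K
      R+K≡N : R ℕ.+ K ≡ N
      R+K≡N = ℕP.m∸n+n≡m K≤N
      rearrange : ∀ R q → 2 ℕ.* (suc q ℕ.* (R ℕ.+ suc (q ℕ.+ q))) ≡ R ℕ.+ suc (q ℕ.+ q) ℕ.* suc (R ℕ.+ suc (q ℕ.+ q))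
      rearrange = ℕSolver.solve-∀
      2s≡ : 2 ℕ.* s ≡ R ℕ.+ K ℕ.* suc N
      2s≡ = begin
        2 ℕ.* s                           ≡⟨ cong (2 ℕ.*_) s≡ ⟩
        2 ℕ.* (suc q ℕ.* N)               ≡⟨ cong (λ n → 2 ℕ.* (suc q ℕ.* n)) R+K≡N ⟨
        2 ℕ.* (suc q ℕ.* (R ℕ.+ K))       ≡⟨ rearrange R q ⟩
        R ℕ.+ K ℕ.* suc (R ℕ.+ K)         ≡⟨ cong (λ n → R ℕ.+ K ℕ.* suc n) R+K≡N ⟩
        R ℕ.+ K ℕ.* suc N                 ∎
        where open ≡-Reasoning

    even-bounded : q₀ ℕ.≤ r₀ → r₀ ℕ.≤ h → 2 ℕ.* s ℕ.≤ N ℕ.* suc N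
    even-bounded q₀≤r₀ r₀≤h = begin
      2 ℕ.* s                    ≡⟨ cong (2 ℕ.*_) s≡r₀+q₀N ⟩
      2 ℕ.* (r₀ ℕ.+ q₀ ℕ.* N)    ≤⟨ ℕP.*-monoʳ-≤ 2 (ℕP.+-mono-≤ r₀≤h (ℕP.*-monoˡ-≤ N (ℕP.≤-trans q₀≤r₀ r₀≤h))) ⟩
      2 ℕ.* (h ℕ.+ h ℕ.* N)      ≡⟨ double h N ⟩
      (h ℕ.+ h) ℕ.* suc N        ≤⟨ ℕP.*-monoˡ-≤ (suc N) 2h≤N ⟩
      N ℕ.* suc N                ∎
      where
      open ℕP.≤-Reasoning
      double : ∀ h n → 2 ℕ.* (h ℕ.+ h ℕ.* n) ≡ (h ℕ.+ h) ℕ.* suc n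
      double = ℕSolver.solve-∀

    odd-bounded : h ℕ.< r₁ → q₁ ℕ.+ r₁ ℕ.≤ N → 2 ℕ.* s ℕ.≤ N ℕ.* suc N
    odd-bounded h<r₁ q₁+r₁≤N = begin
      2 ℕ.* s                                        ≤⟨ ℕP.m≤m+n (2 ℕ.* s) (2 ℕ.* e) ⟩
      2 ℕ.* s ℕ.+ 2 ℕ.* e                            ≡⟨ cong (λ x → 2 ℕ.* x ℕ.+ 2 ℕ.* e) s≡r₁+q₁[N+1] ⟩
      2 ℕ.* (r₁ ℕ.+ q₁ ℕ.* suc N) ℕ.+ 2 ℕ.* e        ≡⟨ cong (λ n → 2 ℕ.* (r₁ ℕ.+ q₁ ℕ.* suc n) ℕ.+ 2 ℕ.* e) q₁+r₁+e≡N ⟨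
      2 ℕ.* (r₁ ℕ.+ q₁ ℕ.* suc (q₁ ℕ.+ r₁ ℕ.+ e)) ℕ.+ 2 ℕ.* e ≡⟨ rearrange q₁ r₁ e ⟩
      (q₁ ℕ.+ r₁ ℕ.+ e) ℕ.* (suc q₁ ℕ.+ suc q₁)     ≡⟨ cong (ℕ._* (suc q₁ ℕ.+ suc q₁)) q₁+r₁+e≡N ⟩
      N ℕ.* (suc q₁ ℕ.+ suc q₁)                      ≤⟨ ℕP.*-monoʳ-≤ N 2q₁+2≤N+1 ⟩
      N ℕ.* suc N                                    ∎
      where
      open ℕP.≤-Reasoning
      e = N ∸ (q₁ ℕ.+ r₁)
      q₁+r₁+e≡N : q₁ ℕ.+ r₁ ℕ.+ e ≡ N
      q₁+r₁+e≡N = ℕP.m+[n∸m]≡n q₁+r₁≤N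
      rearrange : ∀ q r e → 2 ℕ.* (r ℕ.+ q ℕ.* suc (q ℕ.+ r ℕ.+ e)) ℕ.+ 2 ℕ.* e ≡ (q ℕ.+ r ℕ.+ e) ℕ.* (suc q ℕ.+ suc q)
      rearrange = ℕSolver.solve-∀
      q₁+h+1≤N : q₁ ℕ.+ suc h ℕ.≤ N
      q₁+h+1≤N = ℕP.≤-trans (ℕP.+-monoʳ-≤ q₁ h<r₁) q₁+r₁≤N
      interchange : ∀ q h → (q ℕ.+ suc h) ℕ.+ (q ℕ.+ suc h) ≡ (suc q ℕ.+ suc q) ℕ.+ (h ℕ.+ h)
      interchange = ℕSolver.solve-∀
      shuffle : ∀ n h → n ℕ.+ suc (h ℕ.+ h) ≡ suc n ℕ.+ (h ℕ.+ h)
      shuffle = ℕSolver.solve-∀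
      2q₁+2≤N+1 : suc q₁ ℕ.+ suc q₁ ℕ.≤ suc N
      2q₁+2≤N+1 = ℕP.+-cancelʳ-≤ (h ℕ.+ h) (suc q₁ ℕ.+ suc q₁) (suc N)
        (subst₂ ℕ._≤_ (interchange q₁ h) (shuffle N h) (ℕP.+-mono-≤ q₁+h+1≤N (ℕP.≤-trans q₁+h+1≤N N≤2h+1)))

    evenTerm≡evenCoeff-at : r₀ ℕ.≤ h → T (isEven t) → 2 ℕ.* s ℕ.≤ N ℕ.* suc N → evenTerm q₀ r₀ ≡ evenCoeff q₀ r₀
    evenTerm≡evenCoeff-at r₀≤h even bounded with q₀ in q₀≡ | r₀ in r₀≡
    ... | zero  | r     = evenTerm-zero r
    ... | suc q | zero  = ⊥-elim (T-not-both (isOdd t) even (r₀≡0-parity r₀≡ q₀≡ bounded))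
    ... | suc q | suc r = evenTerm≡evenCoeff q r r₀≤h

  coeffφ≡c : ∀ s → 2 ℕ.* s ℕ.≤ N ℕ.* suc N → coeffφ N s ≡ c N s
  coeffφ≡c zero     _       = trans (coeffφ-closed 0) (cong (λ x → + 1 + (+ 0 + x)) (oddA0-outside 0 0 λ { (() , _) }))
  coeffφ≡c (suc s′) bounded = trans (coeffφ-closed (suc s′)) (sym (if-else-if-elim on-odd on-even on-neither))
    where
    open Degree (suc s′)
    on-odd : T (isOdd t ∧ (h <ᵇ r₁)) → oddTerm q₁ r₁ ≡ + 0 + (evenCoeff q₀ r₀ + oddA 0 q₁ r₁)
    on-odd b₁ = trans (oddTerm≡oddA0 q₁ h<r₁ r₁≤N)
      (sym (trans (cong (λ x → + 0 + (x + oddA 0 q₁ r₁)) even≡0) (trans (ℤP.+-identityˡ _) (ℤP.+-identityˡ _))))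
      where
      odd = proj₁ (Equivalence.to T-∧ b₁)
      h<r₁ = ℕP.<ᵇ⇒< h r₁ (proj₂ (Equivalence.to T-∧ b₁))
      even≡0 = evenCoeff-outside q₀ r₀ λ (q₀≤r₀ , r₀≤h) → T-not-both (isOdd t) (even-parity q₀≤r₀ r₀≤h) odd
    on-even : ¬ T (isOdd t ∧ (h <ᵇ r₁)) → T (isEven t ∧ (r₀ ≤ᵇ h)) →
              evenTerm q₀ r₀ ≡ + 0 + (evenCoeff q₀ r₀ + oddA 0 q₁ r₁)
    on-even _ b₂ = trans (evenTerm≡evenCoeff-at r₀≤h even bounded)
      (sym (trans (cong (λ x → + 0 + (evenCoeff q₀ r₀ + x)) odd≡0)
                  (trans (ℤP.+-identityˡ _) (ℤP.+-identityʳ _))))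
      where
      even = proj₁ (Equivalence.to T-∧ b₂)
      r₀≤h = ℕP.≤ᵇ⇒≤ r₀ h (proj₂ (Equivalence.to T-∧ b₂))
      odd≡0 = oddA0-outside q₁ r₁ λ (h<r₁ , _) → T-not-both (isOdd t) even (odd-parity h<r₁)
    on-neither : ¬ T (isOdd t ∧ (h <ᵇ r₁)) → ¬ T (isEven t ∧ (r₀ ≤ᵇ h)) →
                 + 0 ≡ + 0 + (evenCoeff q₀ r₀ + oddA 0 q₁ r₁)
    on-neither ¬b₁ ¬b₂ = sym (cong₂ (λ u v → + 0 + (u + v))
      (evenCoeff-outside q₀ r₀ λ (q₀≤r₀ , r₀≤h) →
        ¬b₂ (Equivalence.from T-∧ (even-parity q₀≤r₀ r₀≤h , ℕP.≤⇒≤ᵇ r₀≤h)))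
      (oddA0-outside q₁ r₁ λ (h<r₁ , _) →
        ¬b₁ (Equivalence.from T-∧ (odd-parity h<r₁ , ℕP.<⇒<ᵇ h<r₁))))

  coeffφ-vanishes : ∀ s → ¬ (2 ℕ.* s ℕ.≤ N ℕ.* suc N) → coeffφ N s ≡ + 0
  coeffφ-vanishes zero     unbounded = ⊥-elim (unbounded z≤n)
  coeffφ-vanishes (suc s′) unbounded = trans (coeffφ-closed (suc s′)) (cong₂ (λ u v → + 0 + (u + v))
    (evenCoeff-outside q₀ r₀ λ (q₀≤r₀ , r₀≤h) → unbounded (even-bounded q₀≤r₀ r₀≤h))
    (oddA0-outside q₁ r₁ λ (h<r₁ , q₁+r₁≤N) → unbounded (odd-bounded h<r₁ q₁+r₁≤N)))
    where open Degree (suc s′)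

open import Data.Nat using (_*_; _+_; _≤_; _<_)

theorem3p5 : (N : ℕ) → .{{_ : NonZero N}} → (s : ℕ) →
    (s ≤ (N * (N + 1)) / 2 → coeffφ N s ≡ c N s) ×
    ((N * (N + 1)) / 2 < s → coeffφ N s ≡ + 0)
theorem3p5 zero     s = ⊥-elim (ℕ.≢-nonZero⁻¹ zero refl)
theorem3p5 (suc N′) s =
  (λ s≤ → coeffφ≡c s (subst (2 ℕ.* s ℕ.≤_) N[N+1]≡ (≤/2⇒2*≤ s≤))) ,
  (λ <s → coeffφ-vanishes s (λ 2s≤ → ℕP.<⇒≱ <s (2*≤⇒≤/2 (subst (2 ℕ.* s ℕ.≤_) (sym N[N+1]≡) 2s≤))))
  where
  open Coefficient N′
  N[N+1]≡ : N ℕ.* (N ℕ.+ 1) ≡ N ℕ.* suc N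
  N[N+1]≡ = cong (N ℕ.*_) (ℕP.+-comm N 1)
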